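{- Let $i\in[n-1]$ and let $D_0,D_1,\dots,D_l$ be an $i$-string in $\mathsf{RPD}_{m,n}$, with associated permutations $u_j=\sigma_{D_j}\in S_{m+n}$. If rows $i$ and $i+1$ of $D_0$ contain only crossing tiles, then $l=0$, $u_0(m+i)=i$ and $u_0(m+i+1)=i+1$. Otherwise: (a) $u_0(m+i)>u_0(m+i+1)$; (b) $u_l^{ -1}(i)>u_l^{ -1}(i+1)$; (c) $u_1=u_2=\dots=u_{l-1}\in\{u_0,\ u_0s_{m+i}\}\cap\{u_l,\ s_iu_l\}$.
   Context: Permutations are composed as functions ($uw=u\circ w$) and $s_k=(k,k+1)$. $\mathsf{RPD}_{m,n}$ is the set of $n\times m$ arrays (rows indexed $1,\dots,n$ top to bottom, columns $1,\dots,m$ left to right) of tiles, each either a bump tile (a pipe from the left edge to the top edge and a pipe from the bottom edge to the right edge) or a crossing tile (a horizontal and a vertical pipe crossing). The pipe entering the left edge of row $r$ is labeled $r$ and the pipe entering the bottom edge of column $j$ is labeled $n+j$. Labels propagate through tiles: in a bump tile the label on the left edge exits through the top and the label on the bottom exits through the right; in a crossing tile with labels $a$ (left) and $b$ (bottom), $\max(a,b)$ exits through the top and $\min(a,b)$ through the right. $\sigma_D\in S_{m+n}$ has one-line notation given by the labels on the top edge read left to right followed by the labels on the right edge read top to bottom. Crystal structure: $[n]=\{1,\dots,n\}$, $\mathbf{e}_k$ standard basis of $\mathbb{Z}^n$. For a subset $T\subseteq[n]$, $\mathrm{wt}(T)=\sum_{j\in T}\mathbf{e}_j$, $e_i(T)=T\cup\{i\}$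 if $T\cap\{i,i+1\}=\{i+1\}$, $T\setminus\{i+1\}$ if $T\cap\{i,i+1\}=\{i,i+1\}$, else $0$; $f_i(T)=T\cup\{i+1\}$ if $T\cap\{i,i+1\}=\{i\}$, $T\setminus\{i\}$ if $T\cap\{i,i+1\}=\{i,i+1\}$, else $0$. With $\varepsilon_i(b)=\sup\{k:e_i^k(b)\ne0\}$, $\varphi_i(b)=\sup\{k:f_i^k(b)\ne0\}$, tensor products have additive weight, $e_i(b\otimes c)=b\otimes e_i(c)$ if $\varepsilon_i(b)\le\varphi_i(c)$ else $e_i(b)\otimes c$, $f_i(b\otimes c)=b\otimes f_i(c)$ if $\varepsilon_i(b)<\varphi_i(c)$ else $f_i(b)\otimes c$, $b\otimes 0=0\otimes c=0$. The set of $m$-tuples $(S_1,\dots,S_m)$ of subsets of $[n]$ is a crystal via $S\leftrightarrow S_1\otimes\cdots\otimes S_m$, and $\mathsf{RPD}_{m,n}$ gets the crystal structure transported along the bijection sending $S$ to the RPD whose tile in row $r$, column $j$ is a bump tile iff $r\in S_j$. An $i$-string is a sequence $D_0,\dots,D_l$ with $e_i(D_0)=0$, $D_j=f_i^j(D_0)$, and $f_i(D_l)=0$. -}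

module Defs where

open import Data.Nat using (ℕ; zero; suc; _+_; _⊔_; _⊓_; _≡ᵇ_; _≤ᵇ_; _<ᵇ_)
open import Data.Bool using (Bool; true; false; if_then_else_)
open import Data.Vec as V using (Vec; []; _∷_)
open import Data.List as L using (List)
open import Data.Maybe as M using (Maybe; just; nothing)
open import Data.Product using (_×_; _,_)
open import Data.Fin using (Fin; toℕ)
open import Data.List.Relation.Unary.All as All using (All)
open import Relation.Binary.PropositionalEquality using (_≡_)

data Tile : Set where
  bump cross : Tile

-- An element of RPD_{m,n}: n rows (top to bottom), each with m tiles
-- (left to right).  Row r (1-indexed) is the (r-1)-th entry.
RPD : ℕ → ℕ → Set
RPD m n = Vec (Vec Tile m) n

-- (left label, bottom label) ↦ (top label, right label)
tileOut : Tile → ℕ → ℕ → ℕ × ℕ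
tileOut bump  a b = a , b
tileOut cross a b = a ⊔ b , a ⊓ b

-- one row: left label, tiles, bottom labels ↦ top labels, right label
rowPass : ∀ {m} → ℕ → Vec Tile m → Vec ℕ m → Vec ℕ m × ℕ
rowPass a [] [] = [] , a
rowPass a (t ∷ ts) (b ∷ bs) with tileOut t a b
... | top , r with rowPass r ts bs
...   | tops , r' = top ∷ tops , r'

-- rows r, r+1, ... (top to bottom), bottom labels of the lowest row
--   ↦ top labels of the top row, right labels of the rows top to bottom
pass : ∀ {m k} → ℕ → Vec (Vec Tile m) k → Vec ℕ m → Vec ℕ m × Vec ℕ k
pass r [] bots = bots , []
pass r (row ∷ rows) bots with pass (suc r) rows bots
... | tops' , rs with rowPass r row tops'
...   | tops , rt = tops , rt ∷ rs

-- pipe entering bottom of column j (1-indexed) is labelled n + j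
bottomLabels : (m n : ℕ) → Vec ℕ m
bottomLabels m n = V.tabulate (λ j → n + suc (toℕ j))

-- σ_D in one-line notation (values in 1..m+n)
σ : ∀ {m n} → RPD m n → List ℕ
σ {m} {n} D with pass 1 D (bottomLabels m n)
... | tops , rights = V.toList tops L.++ V.toList rights

-- u(p) for 1 ≤ p ≤ length u (0 outside this range)
at : List ℕ → ℕ → ℕ
at L.[] _ = 0
at (x L.∷ xs) zero = 0
at (x L.∷ xs) (suc zero) = x
at (x L.∷ xs) (suc (suc k)) = at xs (suc k)

invFrom : ℕ → List ℕ → ℕ → ℕ
invFrom p L.[] v = 0
invFrom p (x L.∷ xs) v = if x ≡ᵇ v then p else invFrom (suc p) xs v

inv : List ℕ → ℕ → ℕ
inv u v = invFrom 1 u v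

s : ℕ → ℕ → ℕ
s k p = if p ≡ᵇ k then suc k else (if p ≡ᵇ suc k then k else p)

-- u s_k  (composition of functions: p ↦ u (s_k p))
mulS : List ℕ → ℕ → List ℕ
mulS u k = L.map (λ p → at u (s k p)) (L.applyUpTo suc (L.length u))

-- s_k u  (p ↦ s_k (u p))
Smul : ℕ → List ℕ → List ℕ
Smul k u = L.map (s k) u

-- Crystal structure on subsets of [n] (as Vec Bool n, 1-indexed)

mem : ∀ {n} → Vec Bool n → ℕ → Bool
mem [] _ = false
mem (b ∷ bs) zero = false
mem (b ∷ bs) (suc zero) = b
mem (b ∷ bs) (suc (suc k)) = mem bs (suc k)

upd : ∀ {n} → Vec Bool n → ℕ → Bool → Vec Bool n
upd [] _ _ = []
upd (b ∷ bs) zero v = b ∷ bs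
upd (b ∷ bs) (suc zero) v = v ∷ bs
upd (b ∷ bs) (suc (suc k)) v = b ∷ upd bs (suc k) v

e₁ : ∀ {n} → ℕ → Vec Bool n → Maybe (Vec Bool n)
e₁ i T with mem T i | mem T (suc i)
... | false | true = just (upd T i true)
... | true  | true = just (upd T (suc i) false)
... | _     | _    = nothing

f₁ : ∀ {n} → ℕ → Vec Bool n → Maybe (Vec Bool n)
f₁ i T with mem T i | mem T (suc i)
... | true | false = just (upd T (suc i) true)
... | true | true  = just (upd T i false)
... | _    | _     = nothing

iterCount : ∀ {A : Set} → (A → Maybe A) → ℕ → A → ℕ
iterCount g zero a = 0
iterCount g (suc k) a with g a
... | nothing = 0
... | just a' = suc (iterCount g k a')

-- crystal operators e_i, f_i (nothing = 0), with a bound 'fuel' on all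
-- string lengths, used to compute ε_i = sup{k : e_i^k ≠ 0} and φ_i.
record Ops (A : Set) : Set where
  field
    e f  : ℕ → A → Maybe A
    fuel : ℕ

ε : ∀ {A} → Ops A → ℕ → A → ℕ
ε O i a = iterCount (Ops.e O i) (Ops.fuel O) a

φ : ∀ {A} → Ops A → ℕ → A → ℕ
φ O i a = iterCount (Ops.f O i) (Ops.fuel O) a

subsetOps : ∀ {n} → Ops (Vec Bool n)
subsetOps = record { e = e₁ ; f = f₁ ; fuel = 3 }

-- tensor product  b ⊗ c  (b a subset, c the tensor product of the rest)
consOps : ∀ {n m} → Ops (Vec Bool n) → Ops (Vec (Vec Bool n) m)
        → Ops (Vec (Vec Bool n) (suc m))
consOps B C = record
  { e = λ { i (b ∷ c) →
        if ε B i b ≤ᵇ φ C i c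
        then M.map (b ∷_) (Ops.e C i c)
        else M.map (_∷ c) (Ops.e B i b) }
  ; f = λ { i (b ∷ c) →
        if ε B i b <ᵇ φ C i c
        then M.map (b ∷_) (Ops.f C i c)
        else M.map (_∷ c) (Ops.f B i b) }
  ; fuel = Ops.fuel B + Ops.fuel C }

-- S₁ ⊗ (S₂ ⊗ (⋯ ⊗ S_m)); the empty tensor product is the trivial crystal
tupOps : ∀ {n} (m : ℕ) → Ops (Vec (Vec Bool n) m)
tupOps zero    = record { e = λ _ _ → nothing ; f = λ _ _ → nothing ; fuel = 0 }
tupOps (suc m) = consOps subsetOps (tupOps m)

isBump : Tile → Bool
isBump bump  = true
isBump cross = false

-- the bijection RPD_{m,n} ≅ (subsets of [n])^m : r ∈ S_j iff tile (r,j) is a bump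
toTuple : ∀ {m n} → RPD m n → Vec (Vec Bool n) m
toTuple D = V.tabulate (λ j → V.map (λ row → isBump (V.lookup row j)) D)

fromTuple : ∀ {m n} → Vec (Vec Bool n) m → RPD m n
fromTuple T = V.tabulate (λ r → V.tabulate (λ j →
                 if V.lookup (V.lookup T j) r then bump else cross))

eR : ∀ {m n} → ℕ → RPD m n → Maybe (RPD m n)
eR {m} i D = M.map fromTuple (Ops.e (tupOps m) i (toTuple D))

fR : ∀ {m n} → ℕ → RPD m n → Maybe (RPD m n)
fR {m} i D = M.map fromTuple (Ops.f (tupOps m) i (toTuple D))

IsString : ∀ {m n} → ℕ → (ℕ → RPD m n) → ℕ → Set
IsString i Ds l =
  (eR i (Ds 0) ≡ nothing) ×
  (∀ j → j Data.Nat.< l → fR i (Ds j) ≡ just (Ds (suc j))) ×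
  (fR i (Ds l) ≡ nothing)

-- row r (1-indexed) of D consists only of crossing tiles
RowAllCross : ∀ {m n} → RPD m n → ℕ → Set
RowAllCross {n = n} D r = ∀ (k : Fin n) → suc (toℕ k) ≡ r → All (_≡ cross) (V.toList (V.lookup D k))

-- σ_D is computed by passing the list of labels upwards through the rows,
-- each row replacing its left label and the labels below it by the labels
-- above it and its right label. The operator f_i changes only rows i and
-- i + 1. Read as a strip of m columns, each column is an element of the
-- crystal of subsets restricted to {i, i + 1}, and by the tensor product rule
-- f_i acts on a single column, turning {i} into {i, i + 1} or {i, i + 1} into
-- {i + 1}. Following the labels through the strip, the first move can only
-- swap the two labels leaving it on the right (u ↦ u s_{m+i}), and only when
-- ε_i = 0; the second can only exchange the labels i and i + 1 entering it on
-- the left, which after the rows above gives u or s_i u, and only when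
-- φ_i = 1. Along an i-string ε_i(D_j) = j and φ_i(D_j) = l - j, so all other
-- steps leave σ unchanged. Finally ε_i = 0 forces the two labels leaving the
-- strip to be decreasing, and φ_i = 0 forces i + 1 to leave before i.

module Submission where

open import Defs
open import Data.Bool using (Bool; true; false; T; if_then_else_)
open import Data.Unit using (tt)
open import Data.Empty using (⊥-elim)
open import Data.Nat using (ℕ; zero; suc; _+_; _∸_; _<_; _≤_; _⊔_; _⊓_; z≤n; s≤s; z<s; _≡ᵇ_; _<ᵇ_; _≤ᵇ_)
open import Data.Nat.Properties
open import Data.Fin using (toℕ; fromℕ<) renaming (zero to fzero; suc to fsuc)
import Data.Fin.Properties as Finₚ
open import Data.Maybe as Maybe using (Maybe; just; nothing)
import Data.Maybe.Properties as Maybeₚ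
open import Data.Vec using (Vec; []; _∷_; toList; lookup; tabulate)
import Data.Vec.Properties as Vecₚ
open import Data.List using (List; []; _∷_; _++_; length; map; applyUpTo; take; drop)
import Data.List.Properties as Listₚ
open import Data.List.Relation.Unary.All as All using (All; []; _∷_)
import Data.List.Relation.Unary.All.Properties as Allₚ
open import Data.List.Relation.Unary.Any using (here; there)
open import Data.List.Relation.Unary.Unique.Propositional using (Unique; []; _∷_)
import Data.List.Relation.Unary.Unique.Propositional.Properties as Uniqueₚ
open import Data.List.Membership.Propositional using (_∈_)
open import Data.List.Relation.Binary.Permutation.Propositional
  using (_↭_; prep; swap; ↭-sym; ↭-refl; ↭-trans; ↭⇒↭ₛ)
open import Data.List.Relation.Binary.Permutation.Propositional.Properties
  using (All-resp-↭; ∈-resp-↭; ↭-length; ++⁺ˡ)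
import Data.List.Relation.Binary.Permutation.Setoid.Properties as Permutationₛ
open import Data.Product using (_×_; _,_; proj₁; proj₂; ∃; ∃₂)
open import Data.Sum as Sum using (_⊎_; inj₁; inj₂)
open import Function.Bundles using (_⇔_; mk⇔; module Equivalence)
open import Relation.Nullary using (¬_; yes; no)
open import Relation.Nullary.Decidable using (_×-dec_)
open import Relation.Nullary.Reflects using (ofʸ; ofⁿ)
open import Relation.Unary using (Decidable)
open import Relation.Binary.Definitions using (tri<; tri≈; tri>)
open import Relation.Binary.PropositionalEquality
  using (_≡_; _≢_; refl; sym; trans; cong; cong₂; subst; subst₂; ≢-sym; setoid; module ≡-Reasoning)

Unique-resp-↭ : ∀ {xs ys : List ℕ} → xs ↭ ys → Unique xs → Unique ys
Unique-resp-↭ p = Permutationₛ.Unique-resp-↭ (setoid ℕ) (↭⇒↭ₛ p)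

≡ᵇ-refl : ∀ p → (p ≡ᵇ p) ≡ true
≡ᵇ-refl zero    = refl
≡ᵇ-refl (suc p) = ≡ᵇ-refl p

≢⇒≡ᵇ≡false : ∀ {p q} → p ≢ q → (p ≡ᵇ q) ≡ false
≢⇒≡ᵇ≡false {p} {q} p≢q with p ≡ᵇ q in eq
... | false = refl
... | true  = ⊥-elim (p≢q (≡ᵇ⇒≡ p q (subst T (sym eq) tt)))

range : ℕ → ℕ → List ℕ
range r zero    = []
range r (suc k) = r ∷ range (suc r) k

range-++ : ∀ r a b → range r a ++ range (r + a) b ≡ range r (a + b)
range-++ r zero    b = cong (λ r′ → range r′ b) (+-identityʳ r)
range-++ r (suc a) b =
  cong (r ∷_) (trans (cong (λ r′ → range (suc r) a ++ range r′ b) (+-suc r a)) (range-++ (suc r) a b))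

range-lower : ∀ r k → All (r ≤_) (range r k)
range-lower r zero    = []
range-lower r (suc k) = ≤-refl ∷ All.map (≤-trans (n≤1+n r)) (range-lower (suc r) k)

range-unique : ∀ r k → Unique (range r k)
range-unique r zero    = []
range-unique r (suc k) = All.map (λ r<p r≡p → <-irrefl r≡p r<p) (range-lower (suc r) k) ∷ range-unique (suc r) k

-- Labels passing through rows

tileOut-↭ : ∀ t a b (K : List ℕ) → proj₁ (tileOut t a b) ∷ proj₂ (tileOut t a b) ∷ K ↭ a ∷ b ∷ K
tileOut-↭ bump  a b K = ↭-refl
tileOut-↭ cross a b K with ≤-total a b
... | inj₁ a≤b rewrite m≤n⇒m⊔n≡n a≤b | m≤n⇒m⊓n≡m a≤b = swap b a ↭-refl
... | inj₂ b≤a rewrite m≥n⇒m⊔n≡m b≤a | m≥n⇒m⊓n≡n b≤a = ↭-refl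

-- The list is the label entering the row from the left, then the labels
-- entering it from below, then anything else; it is replaced by the labels
-- leaving through the top, then the one leaving on the right, then the rest.
-- Lists too short for the row are left alone.
passRow : List Tile → List ℕ → List ℕ
passRow []       K           = K
passRow (t ∷ ts) []          = []
passRow (t ∷ ts) (a ∷ [])    = a ∷ []
passRow (t ∷ ts) (a ∷ b ∷ K) = proj₁ (tileOut t a b) ∷ passRow ts (proj₂ (tileOut t a b) ∷ K)

passRow-↭ : ∀ ts K → passRow ts K ↭ K
passRow-↭ []       K           = ↭-refl
passRow-↭ (t ∷ ts) []          = ↭-refl
passRow-↭ (t ∷ ts) (a ∷ [])    = ↭-refl
passRow-↭ (t ∷ ts) (a ∷ b ∷ K) = ↭-trans (prep _ (passRow-↭ ts _)) (tileOut-↭ t a b K)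

passRow-++ : ∀ ts K M → length ts < length K → passRow ts (K ++ M) ≡ passRow ts K ++ M
passRow-++ []       K           M _         = refl
passRow-++ (t ∷ ts) (a ∷ b ∷ K) M (s≤s lt) = cong (_ ∷_) (passRow-++ ts (_ ∷ K) M lt)

-- Rows r, …, r + k - 1 from top to bottom; row r' has left label r'.
passRows : (ℕ → List Tile) → ℕ → ℕ → List ℕ → List ℕ
passRows row r zero    K = K
passRows row r (suc k) K = passRow (row r) (r ∷ passRows row (suc r) k K)

module _ (row : ℕ → List Tile) where

  passRows-↭ : ∀ r k K → passRows row r k K ↭ range r k ++ K
  passRows-↭ r zero    K = ↭-refl
  passRows-↭ r (suc k) K = ↭-trans (passRow-↭ (row r) _) (prep r (passRows-↭ (suc r) k K))

  passRows-length : ∀ r k K → length (passRows row r k K) ≡ k + length K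
  passRows-length r zero    K = refl
  passRows-length r (suc k) K = trans (↭-length (passRow-↭ (row r) _)) (cong suc (passRows-length (suc r) k K))

  passRows-+ : ∀ r a b K → passRows row r (a + b) K ≡ passRows row r a (passRows row (r + a) b K)
  passRows-+ r zero    b K = cong (λ r′ → passRows row r′ b K) (sym (+-identityʳ r))
  passRows-+ r (suc a) b K =
    cong (λ K′ → passRow (row r) (r ∷ K′))
      (trans (passRows-+ (suc r) a b K) (cong (λ r′ → passRows row (suc r) a (passRows row r′ b K)) (sym (+-suc r a))))

  passRows-++ : ∀ r k K M → (∀ r′ → length (row r′) ≤ length K) →
                passRows row r k (K ++ M) ≡ passRows row r k K ++ M
  passRows-++ r zero    K M short = refl
  passRows-++ r (suc k) K M short =
    trans (cong (λ K′ → passRow (row r) (r ∷ K′)) (passRows-++ (suc r) k K M short))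
          (passRow-++ (row r) (r ∷ passRows row (suc r) k K) M
            (s≤s (≤-trans (short r) (subst (length K ≤_) (sym (passRows-length (suc r) k K)) (m≤n+m _ k)))))

passRows-cong : ∀ {row row′} r k K → (∀ r′ → r ≤ r′ → r′ < r + k → row r′ ≡ row′ r′) →
                passRows row r k K ≡ passRows row′ r k K
passRows-cong r zero    K agree = refl
passRows-cong r (suc k) K agree =
  cong₂ (λ ts K′ → passRow ts (r ∷ K′))
    (agree r ≤-refl (subst (r <_) (sym (+-suc r k)) (s≤s (m≤m+n r k))))
    (passRows-cong (suc r) k K (λ r′ r<r′ r′<r+k →
      agree r′ (<⇒≤ r<r′) (subst (r′ <_) (sym (+-suc r k)) r′<r+k)))

module Transposition (k : ℕ) where

  s-left : s k k ≡ suc k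
  s-left rewrite ≡ᵇ-refl k = refl

  s-right : s k (suc k) ≡ k
  s-right rewrite ≢⇒≡ᵇ≡false (>⇒≢ (n<1+n k)) | ≡ᵇ-refl k = refl

  s-fix : ∀ {p} → p ≢ k → p ≢ suc k → s k p ≡ p
  s-fix p≢k p≢k+1 rewrite ≢⇒≡ᵇ≡false p≢k | ≢⇒≡ᵇ≡false p≢k+1 = refl

  s-fix-above : ∀ {p} → suc k < p → s k p ≡ p
  s-fix-above k+1<p = s-fix (>⇒≢ (<-trans (n<1+n k) k+1<p)) (>⇒≢ k+1<p)

  s-fix-below : ∀ {p} → p < k → s k p ≡ p
  s-fix-below p<k = s-fix (<⇒≢ p<k) (<⇒≢ (<-trans p<k (n<1+n k)))

  s-≤ : ∀ {p} → p ≤ suc k → s k p ≤ suc k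
  s-≤ {p} p≤k+1 with p ≟ k | p ≟ suc k
  ... | yes refl | _        = ≤-reflexive s-left
  ... | no _     | yes refl = subst (_≤ suc k) (sym s-right) (n≤1+n k)
  ... | no p≢k   | no p≢k+1 = subst (_≤ suc k) (sym (s-fix p≢k p≢k+1)) p≤k+1

  s-monotone : ∀ {a b} → a < b → ¬ (a ≡ k × b ≡ suc k) → s k a < s k b
  s-monotone {a} {b} a<b not-k,k+1 with a ≟ k | a ≟ suc k
  ... | yes refl | _ =
    let k+1<b = ≤∧≢⇒< a<b (λ k+1≡b → not-k,k+1 (refl , sym k+1≡b)) in
    subst₂ _<_ (sym s-left) (sym (s-fix-above k+1<b)) k+1<b
  ... | no _ | yes refl = subst₂ _<_ (sym s-right) (sym (s-fix-above a<b)) (<-trans (n<1+n k) a<b)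
  ... | no a≢k | no a≢k+1 with b ≟ k | b ≟ suc k
  ...   | yes refl | _        = subst₂ _<_ (sym (s-fix a≢k a≢k+1)) (sym s-left) (<-trans a<b (n<1+n k))
  ...   | no _     | yes refl = subst₂ _<_ (sym (s-fix a≢k a≢k+1)) (sym s-right) (≤∧≢⇒< (≤-pred a<b) a≢k)
  ...   | no b≢k   | no b≢k+1 = subst₂ _<_ (sym (s-fix a≢k a≢k+1)) (sym (s-fix b≢k b≢k+1)) a<b

  tileOut-s : ∀ t a b → ¬ (a ≡ k × b ≡ suc k) → ¬ (a ≡ suc k × b ≡ k) →
              tileOut t (s k a) (s k b) ≡ (s k (proj₁ (tileOut t a b)) , s k (proj₂ (tileOut t a b)))
  tileOut-s bump  a b _ _ = refl
  tileOut-s cross a b not-k,k+1 not-k+1,k with <-cmp a b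
  ... | tri< a<b _ _ =
    let sa<sb = s-monotone a<b not-k,k+1 in
    cong₂ _,_ (trans (m≤n⇒m⊔n≡n (<⇒≤ sa<sb)) (cong (s k) (sym (m≤n⇒m⊔n≡n (<⇒≤ a<b)))))
              (trans (m≤n⇒m⊓n≡m (<⇒≤ sa<sb)) (cong (s k) (sym (m≤n⇒m⊓n≡m (<⇒≤ a<b)))))
  ... | tri≈ _ refl _ =
    cong₂ _,_ (trans (⊔-idem (s k a)) (cong (s k) (sym (⊔-idem a))))
              (trans (⊓-idem (s k a)) (cong (s k) (sym (⊓-idem a))))
  ... | tri> _ _ b<a =
    let sb<sa = s-monotone b<a (λ (b≡k , a≡k+1) → not-k+1,k (a≡k+1 , b≡k)) in
    cong₂ _,_ (trans (m≥n⇒m⊔n≡m (<⇒≤ sb<sa)) (cong (s k) (sym (m≥n⇒m⊔n≡m (<⇒≤ b<a)))))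
              (trans (m≥n⇒m⊓n≡n (<⇒≤ sb<sa)) (cong (s k) (sym (m≥n⇒m⊓n≡n (<⇒≤ b<a)))))

  avoiding-fixed : ∀ {B} → All (k ≢_) B → All (suc k ≢_) B → All (λ p → s k p ≡ p) B
  avoiding-fixed k∉B k+1∉B = All.zipWith (λ (k≢p , k+1≢p) → s-fix (≢-sym k≢p) (≢-sym k+1≢p)) (k∉B , k+1∉B)

  -- Once the pipes k and k + 1 meet in a crossing tile the larger one leaves
  -- on top whichever way they came in, so from then on relabelling them makes
  -- no difference.
  passRow-map-s : ∀ ts B → Unique B →
    passRow ts (map (s k) B) ≡ map (s k) (passRow ts B)
    ⊎ (k ∈ B × suc k ∈ B × passRow ts (map (s k) B) ≡ passRow ts B)
  passRow-map-s-∷ : ∀ t ts a b B → Unique (a ∷ b ∷ B) →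
    tileOut t (s k a) (s k b) ≡ (s k (proj₁ (tileOut t a b)) , s k (proj₂ (tileOut t a b))) →
    passRow (t ∷ ts) (map (s k) (a ∷ b ∷ B)) ≡ map (s k) (passRow (t ∷ ts) (a ∷ b ∷ B))
    ⊎ (k ∈ a ∷ b ∷ B × suc k ∈ a ∷ b ∷ B × passRow (t ∷ ts) (map (s k) (a ∷ b ∷ B)) ≡ passRow (t ∷ ts) (a ∷ b ∷ B))

  passRow-map-s []       B           u = inj₁ refl
  passRow-map-s (t ∷ ts) []          u = inj₁ refl
  passRow-map-s (t ∷ ts) (a ∷ [])    u = inj₁ refl
  passRow-map-s (bump ∷ ts) (a ∷ b ∷ B) u = passRow-map-s-∷ bump ts a b B u refl
  passRow-map-s (cross ∷ ts) (a ∷ b ∷ B) u with (a ≟ k ×-dec b ≟ suc k) | (a ≟ suc k ×-dec b ≟ k)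
  passRow-map-s (cross ∷ ts) (a ∷ b ∷ B) ((_ ∷ k∉B) ∷ k+1∉B ∷ _) | yes (refl , refl) | _
    rewrite s-left | s-right | Listₚ.map-id-local (avoiding-fixed k∉B k+1∉B) =
    inj₂ (here refl , there (here refl) , cong₂ (λ x y → x ∷ passRow ts (y ∷ B)) (⊔-comm (suc k) k) (⊓-comm (suc k) k))
  passRow-map-s (cross ∷ ts) (a ∷ b ∷ B) ((_ ∷ k+1∉B) ∷ k∉B ∷ _) | _ | yes (refl , refl)
    rewrite s-left | s-right | Listₚ.map-id-local (avoiding-fixed k∉B k+1∉B) =
    inj₂ (there (here refl) , here refl , cong₂ (λ x y → x ∷ passRow ts (y ∷ B)) (⊔-comm k (suc k)) (⊓-comm k (suc k)))
  passRow-map-s (cross ∷ ts) (a ∷ b ∷ B) u | no not-k,k+1 | no not-k+1,k =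
    passRow-map-s-∷ cross ts a b B u (tileOut-s cross a b not-k,k+1 not-k+1,k)

  passRow-map-s-∷ t ts a b B u tile-s rewrite tile-s
    with Unique-resp-↭ (↭-sym (tileOut-↭ t a b B)) u
  ... | top∉ ∷ u′ with passRow-map-s ts (proj₂ (tileOut t a b) ∷ B) u′
  ...   | inj₁ eq = inj₁ (cong (_ ∷_) eq)
  ...   | inj₂ (k∈ , k+1∈ , eq) =
    inj₂ ( ∈-resp-↭ (tileOut-↭ t a b B) (there k∈)
         , ∈-resp-↭ (tileOut-↭ t a b B) (there k+1∈)
         , cong₂ _∷_ (s-fix (All.lookup top∉ k∈) (All.lookup top∉ k+1∈)) eq)

  passRows-map-s : ∀ row r j O → r + j ≤ k → Unique (range r j ++ O) →
    passRows row r j (map (s k) O) ≡ map (s k) (passRows row r j O)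
    ⊎ passRows row r j (map (s k) O) ≡ passRows row r j O
  passRows-map-s row r zero    O _       _ = inj₁ refl
  passRows-map-s row r (suc j) O r+j<k u@(_ ∷ u′)
    with passRows-map-s row (suc r) j O (subst (_≤ k) (+-suc r j) r+j<k) u′
  ... | inj₂ eq = inj₂ (cong (λ K → passRow (row r) (r ∷ K)) eq)
  ... | inj₁ eq =
    Sum.map (trans relabel-left) (λ (_ , _ , eq′) → trans relabel-left eq′)
      (passRow-map-s (row r) (r ∷ passRows row (suc r) j O)
        (Unique-resp-↭ (↭-sym (prep r (passRows-↭ row (suc r) j O))) u))
    where
    relabel-left : passRow (row r) (r ∷ passRows row (suc r) j (map (s k) O))
                 ≡ passRow (row r) (map (s k) (r ∷ passRows row (suc r) j O))
    relabel-left = cong (passRow (row r)) (cong₂ _∷_ (sym (s-fix-below (<-≤-trans (m<m+n r z<s) r+j<k))) eq)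

at-middle : ∀ (A : List ℕ) x B → at (A ++ x ∷ B) (suc (length A)) ≡ x
at-middle []      x B = refl
at-middle (a ∷ A) x B = at-middle A x B

at-middle₂ : ∀ (A : List ℕ) x y B → at (A ++ x ∷ y ∷ B) (suc (suc (length A))) ≡ y
at-middle₂ []      x y B = refl
at-middle₂ (a ∷ A) x y B = at-middle₂ A x y B

at-swap-other : ∀ (A : List ℕ) x y B p → p ≢ suc (length A) → p ≢ suc (suc (length A)) →
                at (A ++ x ∷ y ∷ B) p ≡ at (A ++ y ∷ x ∷ B) p
at-swap-other []      x y B zero                _  _  = refl
at-swap-other []      x y B (suc zero)          p≢ _  = ⊥-elim (p≢ refl)
at-swap-other []      x y B (suc (suc zero))    _  p≢ = ⊥-elim (p≢ refl)
at-swap-other []      x y B (suc (suc (suc p))) _  _  = refl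
at-swap-other (a ∷ A) x y B zero                _  _  = refl
at-swap-other (a ∷ A) x y B (suc zero)          _  _  = refl
at-swap-other (a ∷ A) x y B (suc (suc p)) p≢ p≢′ =
  at-swap-other A x y B (suc p) (λ e → p≢ (cong suc e)) (λ e → p≢′ (cong suc e))

applyUpTo-at : ∀ (xs : List ℕ) f → (∀ j → j < length xs → f j ≡ at xs (suc j)) → applyUpTo f (length xs) ≡ xs
applyUpTo-at []       f agree = refl
applyUpTo-at (x ∷ xs) f agree =
  cong₂ _∷_ (agree 0 z<s) (applyUpTo-at xs (λ j → f (suc j)) (λ j j< → agree (suc j) (s≤s j<)))

mulS-swap : ∀ (A : List ℕ) x y B → mulS (A ++ x ∷ y ∷ B) (suc (length A)) ≡ A ++ y ∷ x ∷ B
mulS-swap A x y B =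
  begin
    map (λ p → at u (s k p)) (applyUpTo suc (length u))
  ≡⟨ Listₚ.map-applyUpTo suc _ (length u) ⟩
    applyUpTo (λ j → at u (s k (suc j))) (length u)
  ≡⟨ cong (applyUpTo _) (trans (Listₚ.length-++ A) (sym (Listₚ.length-++ A))) ⟩
    applyUpTo (λ j → at u (s k (suc j))) (length u′)
  ≡⟨ applyUpTo-at u′ _ (λ j _ → entry (suc j)) ⟩
    u′
  ∎
  where
  open ≡-Reasoning
  open Transposition (suc (length A))
  k = suc (length A)
  u  = A ++ x ∷ y ∷ B
  u′ = A ++ y ∷ x ∷ B
  entry : ∀ p → at u (s k p) ≡ at u′ p
  entry p with p ≟ k | p ≟ suc k
  ... | yes refl | _ = trans (cong (at u) s-left) (trans (at-middle₂ A x y B) (sym (at-middle A y (x ∷ B))))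
  ... | no _ | yes refl = trans (cong (at u) s-right) (trans (at-middle A x (y ∷ B)) (sym (at-middle₂ A y x B)))
  ... | no p≢k | no p≢k+1 = trans (cong (at u) (s-fix p≢k p≢k+1)) (at-swap-other A x y B p p≢k p≢k+1)

data Before (p q : ℕ) : List ℕ → Set where
  found : ∀ {L} → q ∈ L → Before p q (p ∷ L)
  skip  : ∀ {x L} → x ≢ p → x ≢ q → Before p q L → Before p q (x ∷ L)

Before-uncons : ∀ {p q x L} → Before p q (x ∷ L) → (x ≡ p × q ∈ L) ⊎ (x ≢ p × x ≢ q × Before p q L)
Before-uncons (found q∈L)           = inj₁ (refl , q∈L)
Before-uncons (skip x≢p x≢q before) = inj₂ (x≢p , x≢q , before)

invFrom-≥ : ∀ j L q → q ∈ L → j ≤ invFrom j L q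
invFrom-≥ j (x ∷ L) q (here refl) rewrite ≡ᵇ-refl q = ≤-refl
invFrom-≥ j (x ∷ L) q (there q∈L) with x ≡ᵇ q
... | true  = ≤-refl
... | false = ≤-trans (n≤1+n j) (invFrom-≥ (suc j) L q q∈L)

Before⇒invFrom< : ∀ {p q} j L → Before p q L → p ≢ q → invFrom j L p < invFrom j L q
Before⇒invFrom< {p} {q} j (p ∷ L) (found q∈L) p≢q
  rewrite ≡ᵇ-refl p | ≢⇒≡ᵇ≡false p≢q = invFrom-≥ (suc j) L q q∈L
Before⇒invFrom< j (x ∷ L) (skip x≢p x≢q before) p≢q
  rewrite ≢⇒≡ᵇ≡false x≢p | ≢⇒≡ᵇ≡false x≢q = Before⇒invFrom< (suc j) L before p≢q

selected-≢ : ∀ {a b v x : ℕ} → v ≡ a ⊎ v ≡ b → a ≢ x → b ≢ x → v ≢ x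
selected-≢ (inj₁ refl) a≢x _   = a≢x
selected-≢ (inj₂ refl) _   b≢x = b≢x

-- A crossing tile lets the larger label out on top, so q never overtakes p.
Before-tile : ∀ t {p q a b K} → q < p → Before p q (a ∷ b ∷ K) →
              Before p q (proj₁ (tileOut t a b) ∷ proj₂ (tileOut t a b) ∷ K)
Before-tile bump q<p before = before
Before-tile cross {p} {q} {b = b} {K} q<p (found q∈bK) with <-cmp p b
... | tri< p<b _ _ rewrite m≤n⇒m⊔n≡n (<⇒≤ p<b) | m≤n⇒m⊓n≡m (<⇒≤ p<b) =
  skip (>⇒≢ p<b) (>⇒≢ (<-trans q<p p<b)) (found (q∈K q∈bK))
  where
  q∈K : q ∈ b ∷ K → q ∈ K
  q∈K (here q≡b)  = ⊥-elim (<⇒≢ (<-trans q<p p<b) q≡b)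
  q∈K (there q∈K) = q∈K
... | tri≈ _ refl _ rewrite ⊔-idem p | ⊓-idem p = found q∈bK
... | tri> _ _ b<p rewrite m≥n⇒m⊔n≡m (<⇒≤ b<p) | m≥n⇒m⊓n≡n (<⇒≤ b<p) = found q∈bK
Before-tile cross {p} {a = a} q<p (skip a≢p a≢q (found q∈K)) with <-cmp a p
... | tri< a<p _ _ rewrite m≤n⇒m⊔n≡n (<⇒≤ a<p) | m≤n⇒m⊓n≡m (<⇒≤ a<p) = found (there q∈K)
... | tri≈ _ a≡p _ = ⊥-elim (a≢p a≡p)
... | tri> _ _ p<a rewrite m≥n⇒m⊔n≡m (<⇒≤ p<a) | m≥n⇒m⊓n≡n (<⇒≤ p<a) = skip a≢p a≢q (found q∈K)
Before-tile cross {a = a} {b} q<p (skip a≢p a≢q (skip b≢p b≢q before)) =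
  skip (selected-≢ (⊔-sel a b) a≢p b≢p) (selected-≢ (⊔-sel a b) a≢q b≢q)
    (skip (selected-≢ (⊓-sel a b) a≢p b≢p) (selected-≢ (⊓-sel a b) a≢q b≢q) before)

Before-passRow : ∀ ts {p q} K → q < p → Before p q K → Before p q (passRow ts K)
Before-passRow []       K           q<p before = before
Before-passRow (t ∷ ts) []          q<p before = before
Before-passRow (t ∷ ts) (a ∷ [])    q<p before = before
Before-passRow (t ∷ ts) {p} {q} (a ∷ b ∷ K) q<p before with Before-uncons (Before-tile t q<p before)
... | inj₁ (top≡p , q∈) =
  subst (λ x → Before p q (x ∷ passRow ts (proj₂ (tileOut t a b) ∷ K))) (sym top≡p)
    (found (∈-resp-↭ (↭-sym (passRow-↭ ts _)) q∈))
... | inj₂ (top≢p , top≢q , before′) = skip top≢p top≢q (Before-passRow ts _ q<p before′)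

Before-passRows : ∀ row r j {p q} O → q < p → r + j ≤ q → Before p q O → Before p q (passRows row r j O)
Before-passRows row r zero    O q<p _     before = before
Before-passRows row r (suc j) {p} {q} O q<p r+j<q before =
  Before-passRow (row r) _ q<p
    (skip (<⇒≢ (<-trans r<q q<p)) (<⇒≢ r<q)
      (Before-passRows row (suc r) j O q<p (subst (_≤ q) (+-suc r j) r+j<q) before))
  where r<q = <-≤-trans (m<m+n r z<s) r+j<q

-- Rows i and i + 1 as a strip of columns

-- Column j of rows i and i + 1: whether its tile in row i, resp. i + 1, is a
-- bump, and the label entering it from below.
Col : Set
Col = Bool × Bool × ℕ

tileOf : Bool → Tile
tileOf b = if b then bump else cross

label : Col → ℕ
label (_ , _ , z) = z

labels : List Col → List ℕ
labels = map label

-- x and y enter the column from the left in rows i and i + 1.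
colTop colUpper colLower : Col → ℕ → ℕ → ℕ
colTop   (a , b , z) x y = proj₁ (tileOut (tileOf a) x (proj₁ (tileOut (tileOf b) y z)))
colUpper (a , b , z) x y = proj₂ (tileOut (tileOf a) x (proj₁ (tileOut (tileOf b) y z)))
colLower (a , b , z) x y = proj₂ (tileOut (tileOf b) y z)

colOut-↭ : ∀ c x y (K : List ℕ) → colTop c x y ∷ colUpper c x y ∷ colLower c x y ∷ K ↭ x ∷ y ∷ label c ∷ K
colOut-↭ c@(a , b , z) x y K =
  ↭-trans (tileOut-↭ (tileOf a) x _ (colLower c x y ∷ K)) (prep x (tileOut-↭ (tileOf b) y z K))

colOut-unique : ∀ c x y K → Unique (x ∷ y ∷ label c ∷ K) → Unique (colUpper c x y ∷ colLower c x y ∷ K)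
colOut-unique c x y K u with Unique-resp-↭ (↭-sym (colOut-↭ c x y K)) u
... | _ ∷ u′ = u′

passStrip : List Col → ℕ → ℕ → List ℕ → List ℕ
passStrip []       x y S = x ∷ y ∷ S
passStrip (c ∷ cs) x y S = colTop c x y ∷ passStrip cs (colUpper c x y) (colLower c x y) S

passStrip-↭ : ∀ W x y S → passStrip W x y S ↭ x ∷ y ∷ labels W ++ S
passStrip-↭ []       x y S = ↭-refl
passStrip-↭ (c ∷ cs) x y S = ↭-trans (prep _ (passStrip-↭ cs _ _ S)) (colOut-↭ c x y (labels cs ++ S))

stripExits : List Col → ℕ → ℕ → ℕ × ℕ
stripExits []       x y = x , y
stripExits (c ∷ cs) x y = stripExits cs (colUpper c x y) (colLower c x y)

passStrip-exits : ∀ W x y S → ∃ λ A → length A ≡ length W ×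
                  passStrip W x y S ≡ A ++ proj₁ (stripExits W x y) ∷ proj₂ (stripExits W x y) ∷ S
passStrip-exits []       x y S = [] , refl , refl
passStrip-exits (c ∷ cs) x y S =
  let A , length-A , eq = passStrip-exits cs (colUpper c x y) (colLower c x y) S
  in colTop c x y ∷ A , cong suc length-A , cong (colTop c x y ∷_) eq

-- In a single column {i}, {i, i + 1}, {i + 1} form an i-string; ∅ is isolated.
εcol φcol : Col → ℕ
εcol (false , false , _) = 0
εcol (true  , false , _) = 0
εcol (true  , true  , _) = 1
εcol (false , true  , _) = 2
φcol (false , false , _) = 0
φcol (true  , false , _) = 2
φcol (true  , true  , _) = 1
φcol (false , true  , _) = 0

φ⊗ ε⊗ : List Col → ℕ
φ⊗ []       = 0
φ⊗ (c ∷ cs) = φcol c + (φ⊗ cs ∸ εcol c)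
ε⊗ []       = 0
ε⊗ (c ∷ cs) = ε⊗ cs + (εcol c ∸ φ⊗ cs)

data FCol : Col → Col → Set where
  add-i+1  : ∀ {z} → FCol (true , false , z) (true , true , z)
  remove-i : ∀ {z} → FCol (true , true , z) (false , true , z)

data FStep : List Col → List Col → Set where
  f-here  : ∀ {c c′ cs} → FCol c c′ → φ⊗ cs ≤ εcol c → FStep (c ∷ cs) (c′ ∷ cs)
  f-there : ∀ {c cs cs′} → εcol c < φ⊗ cs → FStep cs cs′ → FStep (c ∷ cs) (c ∷ cs′)

FCol-ε : ∀ {c c′} → FCol c c′ → εcol c′ ≡ suc (εcol c)
FCol-ε add-i+1  = refl
FCol-ε remove-i = refl

FCol-φ : ∀ {c c′} → FCol c c′ → φcol c ≡ suc (φcol c′)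
FCol-φ add-i+1  = refl
FCol-φ remove-i = refl

suc-+-∸ : ∀ a q e → e ≤ q → suc (a + (q ∸ e)) ≡ a + (suc q ∸ e)
suc-+-∸ a q e e≤q = trans (sym (+-suc a (q ∸ e))) (cong (a +_) (sym (+-∸-assoc 1 e≤q)))

FStep-φ : ∀ {W W′} → FStep W W′ → suc (φ⊗ W′) ≡ φ⊗ W
FStep-φ (f-here {cs = cs} f φ≤ε)
  rewrite m≤n⇒m∸n≡0 (subst (φ⊗ cs ≤_) (sym (FCol-ε f)) (m≤n⇒m≤1+n φ≤ε))
        | m≤n⇒m∸n≡0 φ≤ε | FCol-φ f = refl
FStep-φ (f-there {c} {cs} {cs′} ε<φ step) =
  trans (suc-+-∸ (φcol c) (φ⊗ cs′) (εcol c) (≤-pred (subst (εcol c <_) (sym (FStep-φ step)) ε<φ)))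
        (cong (λ p → φcol c + (p ∸ εcol c)) (FStep-φ step))

FStep-ε : ∀ {W W′} → FStep W W′ → ε⊗ W′ ≡ suc (ε⊗ W)
FStep-ε (f-here {c} {cs = cs} f φ≤ε)
  rewrite FCol-ε f | +-∸-assoc 1 φ≤ε = +-suc (ε⊗ cs) (εcol c ∸ φ⊗ cs)
FStep-ε (f-there {c} {cs} {cs′} ε<φ step)
  rewrite m≤n⇒m∸n≡0 (≤-pred (subst (εcol c <_) (sym (FStep-φ step)) ε<φ))
        | m≤n⇒m∸n≡0 (<⇒≤ ε<φ) | FStep-ε step = refl

data Crossing : Col → Set where
  crossing : ∀ {z} → Crossing (false , false , z)

crossing? : Decidable Crossing
crossing? (false , false , z) = yes crossing
crossing? (false , true  , z) = no λ ()
crossing? (true  , _     , z) = no λ ()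

All-crossing-φ : ∀ {W} → All Crossing W → φ⊗ W ≡ 0
All-crossing-φ []                = refl
All-crossing-φ (crossing ∷ rest) = All-crossing-φ rest

FStep-not-crossing : ∀ {W W′} → FStep W W′ → ¬ All Crossing W′
FStep-not-crossing (f-here add-i+1  _) (() ∷ _)
FStep-not-crossing (f-here remove-i _) (() ∷ _)
FStep-not-crossing (f-there _ step)    (_ ∷ rest) = FStep-not-crossing step rest

⊓<⊔ : ∀ {y z} → y ≢ z → y ⊓ z < y ⊔ z
⊓<⊔ {y} {z} y≢z with <-cmp y z
... | tri< y<z _ _ rewrite m≤n⇒m⊓n≡m (<⇒≤ y<z) | m≤n⇒m⊔n≡n (<⇒≤ y<z) = y<z
... | tri≈ _ y≡z _ = ⊥-elim (y≢z y≡z)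
... | tri> _ _ z<y rewrite m≥n⇒m⊓n≡n (<⇒≤ z<y) | m≥n⇒m⊔n≡m (<⇒≤ z<y) = z<y

⊓<⊓⊔ : ∀ {x y z} → y < x → z ≢ y → y ⊓ z < x ⊓ (y ⊔ z)
⊓<⊓⊔ {x} {y} {z} y<x z≢y with <-cmp y z
... | tri< y<z _ _ rewrite m≤n⇒m⊓n≡m (<⇒≤ y<z) | m≤n⇒m⊔n≡n (<⇒≤ y<z) = ⊓-glb y<x y<z
... | tri≈ _ y≡z _ = ⊥-elim (z≢y (sym y≡z))
... | tri> _ _ z<y rewrite m≥n⇒m⊓n≡n (<⇒≤ z<y) | m≥n⇒m⊔n≡m (<⇒≤ z<y) | m≥n⇒m⊓n≡n (<⇒≤ y<x) = z<y

crossing-exits-descending : ∀ W x y → All Crossing W → y < x → Unique (x ∷ y ∷ labels W) →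
                            proj₂ (stripExits W x y) < proj₁ (stripExits W x y)
crossing-exits-descending []       x y []                y<x u = y<x
crossing-exits-descending (c ∷ cs) x y (crossing ∷ rest) y<x u@(_ ∷ (y≢z ∷ _) ∷ _) =
  crossing-exits-descending cs _ _ rest (⊓<⊓⊔ y<x (≢-sym y≢z)) (colOut-unique c x y _ u)

crossing-exits : ∀ W x y → All Crossing W → All (x <_) (labels W) → All (y <_) (labels W) →
                 stripExits W x y ≡ (x , y)
crossing-exits []       x y []                _           _           = refl
crossing-exits (c ∷ cs) x y (crossing ∷ rest) (x<z ∷ x<zs) (y<z ∷ y<zs)
  rewrite m≤n⇒m⊔n≡n (<⇒≤ y<z) | m≤n⇒m⊓n≡m (<⇒≤ y<z) | m≤n⇒m⊓n≡m (<⇒≤ x<z) =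
  crossing-exits cs x y rest x<zs y<zs

head-ε≡0 : ∀ c cs → All Crossing cs → ε⊗ (c ∷ cs) ≡ 0 → εcol c ≡ 0
head-ε≡0 c cs rest ε≡0 = subst (λ p → εcol c ∸ p ≡ 0) (All-crossing-φ rest) (m+n≡0⇒n≡0 (ε⊗ cs) ε≡0)

-- Past the last non-crossing column, which has ε = 0 and so is {i}, the two
-- labels travel on in decreasing order.
exits-descending : ∀ W x y → ε⊗ W ≡ 0 → ¬ All Crossing W → Unique (x ∷ y ∷ labels W) →
                   proj₂ (stripExits W x y) < proj₁ (stripExits W x y)
exits-descending []       x y _   not-all _ = ⊥-elim (not-all [])
exits-descending (c ∷ cs) x y ε≡0 not-all u with All.all? crossing? cs
... | no not-all′ = exits-descending cs _ _ (m+n≡0⇒m≡0 (ε⊗ cs) ε≡0) not-all′ (colOut-unique c x y _ u)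
... | yes rest = last-non-crossing c (head-ε≡0 c cs rest ε≡0) (λ c-crossing → not-all (c-crossing ∷ rest)) u
  where
  last-non-crossing : ∀ c → εcol c ≡ 0 → ¬ Crossing c → Unique (x ∷ y ∷ label c ∷ labels cs) →
                      proj₂ (stripExits (c ∷ cs) x y) < proj₁ (stripExits (c ∷ cs) x y)
  last-non-crossing (false , false , z) _ not-crossing _ = ⊥-elim (not-crossing crossing)
  last-non-crossing (true  , false , z) _ _ u@(_ ∷ (y≢z ∷ _) ∷ _) =
    crossing-exits-descending cs _ _ rest (⊓<⊔ y≢z) (colOut-unique (true , false , z) x y _ u)
  last-non-crossing (true  , true  , z) () _ _
  last-non-crossing (false , true  , z) () _ _

SwappedAt : ℕ → List ℕ → List ℕ → List ℕ → Set
SwappedAt k S O O′ = ∃ λ A → ∃₂ λ P Q → length A ≡ k × O ≡ A ++ P ∷ Q ∷ S × O′ ≡ A ++ Q ∷ P ∷ S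

ExitChange : List Col → List ℕ → List ℕ → List ℕ → Set
ExitChange W S O O′ = O′ ≡ O ⊎ (ε⊗ W ≡ 0 × SwappedAt (length W) S O O′)

ExitChange-∷ : ∀ c cs S t {O O′} → εcol c ≤ φ⊗ cs → ExitChange cs S O O′ → ExitChange (c ∷ cs) S (t ∷ O) (t ∷ O′)
ExitChange-∷ c cs S t ε≤φ (inj₁ eq) = inj₁ (cong (t ∷_) eq)
ExitChange-∷ c cs S t ε≤φ (inj₂ (ε≡0 , A , P , Q , length-A , eq , eq′)) =
  inj₂ ( trans (cong (ε⊗ cs +_) (m≤n⇒m∸n≡0 ε≤φ)) (trans (+-identityʳ (ε⊗ cs)) ε≡0)
       , t ∷ A , P , Q , cong suc length-A , cong (t ∷_) eq , cong (t ∷_) eq′)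

-- With φ = 0 the first column is crossing or {i + 1}: a column {i + 1} gives
-- the same output for both orders of the entering labels, and a crossing
-- column passes the pair on, possibly swapped.
passStrip-swap-inputs : ∀ cs P Q S → Q < P → Unique (P ∷ Q ∷ labels cs) → φ⊗ cs ≡ 0 →
                        ExitChange cs S (passStrip cs P Q S) (passStrip cs Q P S)
passStrip-swap-inputs [] P Q S Q<P u φ≡0 = inj₂ (refl , [] , P , Q , refl , refl , refl)
passStrip-swap-inputs ((false , false , z) ∷ cs) P Q S Q<P ((P≢Q ∷ P≢z ∷ P∉) ∷ (Q≢z ∷ Q∉) ∷ z∉ ∷ u) φ≡0
  with <-cmp Q z
... | tri≈ _ Q≡z _ = ⊥-elim (Q≢z Q≡z)
... | tri> _ _ z<Q
  rewrite m≥n⇒m⊔n≡m (<⇒≤ z<Q) | m≥n⇒m⊓n≡n (<⇒≤ z<Q)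
        | m≥n⇒m⊔n≡m (<⇒≤ (<-trans z<Q Q<P)) | m≥n⇒m⊓n≡n (<⇒≤ (<-trans z<Q Q<P))
        | m≥n⇒m⊔n≡m (<⇒≤ Q<P) | m≥n⇒m⊓n≡n (<⇒≤ Q<P) | m≤n⇒m⊔n≡n (<⇒≤ Q<P) | m≤n⇒m⊓n≡m (<⇒≤ Q<P) =
  inj₁ refl
... | tri< Q<z _ _ with <-cmp P z
...   | tri≈ _ P≡z _ = ⊥-elim (P≢z P≡z)
...   | tri< P<z _ _
  rewrite m≤n⇒m⊔n≡n (<⇒≤ Q<z) | m≤n⇒m⊓n≡m (<⇒≤ Q<z) | m≤n⇒m⊔n≡n (<⇒≤ P<z) | m≤n⇒m⊓n≡m (<⇒≤ P<z)
        | m≤n⇒m⊔n≡n (<⇒≤ Q<z) | m≤n⇒m⊓n≡m (<⇒≤ Q<z) =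
  ExitChange-∷ (false , false , z) cs S z z≤n (passStrip-swap-inputs cs P Q S Q<P ((P≢Q ∷ P∉) ∷ Q∉ ∷ u) φ≡0)
...   | tri> _ _ z<P
  rewrite m≤n⇒m⊔n≡n (<⇒≤ Q<z) | m≤n⇒m⊓n≡m (<⇒≤ Q<z) | m≥n⇒m⊔n≡m (<⇒≤ z<P) | m≥n⇒m⊓n≡n (<⇒≤ z<P)
        | m≤n⇒m⊔n≡n (<⇒≤ Q<P) | m≤n⇒m⊓n≡m (<⇒≤ Q<P) =
  ExitChange-∷ (false , false , z) cs S P z≤n
    (passStrip-swap-inputs cs z Q S Q<z ((≢-sym Q≢z ∷ z∉) ∷ Q∉ ∷ u) φ≡0)
passStrip-swap-inputs ((false , true , z) ∷ cs) P Q S Q<P u φ≡0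
  rewrite m≥n⇒m⊔n≡m (<⇒≤ Q<P) | m≥n⇒m⊓n≡n (<⇒≤ Q<P) | m≤n⇒m⊔n≡n (<⇒≤ Q<P) | m≤n⇒m⊓n≡m (<⇒≤ Q<P) =
  inj₁ refl
passStrip-swap-inputs ((true , false , z) ∷ cs) P Q S Q<P u ()
passStrip-swap-inputs ((true , true  , z) ∷ cs) P Q S Q<P u ()

FStep-exits-add : ∀ z cs x y S → φ⊗ cs ≤ 0 → Unique (x ∷ y ∷ z ∷ labels cs) →
  ExitChange ((true , false , z) ∷ cs) S (passStrip ((true , false , z) ∷ cs) x y S)
                                         (passStrip ((true , true , z) ∷ cs) x y S)
FStep-exits-add z cs x y S φ≤0 ((x≢y ∷ x≢z ∷ x∉) ∷ (y≢z ∷ y∉) ∷ z∉ ∷ u) with <-cmp y z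
... | tri≈ _ y≡z _ = ⊥-elim (y≢z y≡z)
... | tri> _ _ z<y rewrite m≥n⇒m⊔n≡m (<⇒≤ z<y) | m≥n⇒m⊓n≡n (<⇒≤ z<y) = inj₁ refl
... | tri< y<z _ _ rewrite m≤n⇒m⊔n≡n (<⇒≤ y<z) | m≤n⇒m⊓n≡m (<⇒≤ y<z) =
  ExitChange-∷ (true , false , z) cs S x z≤n
    (passStrip-swap-inputs cs z y S y<z ((≢-sym y≢z ∷ z∉) ∷ y∉ ∷ u) (n≤0⇒n≡0 φ≤0))

-- f changes the label leaving a column on top only when it turns {i, i + 1}
-- into {i + 1} while the labels enter that column in increasing order. Each
-- of the two hypotheses below rules this out, and one of them holds again to
-- the right of any column that f passes over.
FStep-exits-descending : ∀ {W W′} → FStep W W′ → ∀ x y S → y < x → Unique (x ∷ y ∷ labels W) →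
                         ExitChange W S (passStrip W x y S) (passStrip W′ x y S)
FStep-exits-φ≥2 : ∀ {W W′} → FStep W W′ → ∀ x y S → 2 ≤ φ⊗ W → Unique (x ∷ y ∷ labels W) →
                  ExitChange W S (passStrip W x y S) (passStrip W′ x y S)

FStep-exits-descending (f-here {cs = cs} (add-i+1 {z}) φ≤0) x y S y<x u = FStep-exits-add z cs x y S φ≤0 u
FStep-exits-descending (f-here remove-i _) x y S y<x u
  rewrite m≥n⇒m⊔n≡m (<⇒≤ y<x) | m≥n⇒m⊓n≡n (<⇒≤ y<x) = inj₁ refl
FStep-exits-descending (f-there {c@(false , false , z)} {cs} ε<φ step) x y S y<x u@(_ ∷ (y≢z ∷ _) ∷ _) =
  ExitChange-∷ c cs S _ (<⇒≤ ε<φ)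
    (FStep-exits-descending step _ _ S (⊓<⊓⊔ y<x (≢-sym y≢z)) (colOut-unique c x y _ u))
FStep-exits-descending (f-there {c@(true , false , z)} {cs} ε<φ step) x y S y<x u@(_ ∷ (y≢z ∷ _) ∷ _) =
  ExitChange-∷ c cs S _ (<⇒≤ ε<φ) (FStep-exits-descending step _ _ S (⊓<⊔ y≢z) (colOut-unique c x y _ u))
FStep-exits-descending (f-there {c@(false , true , z)} {cs} ε<φ step) x y S y<x u =
  ExitChange-∷ c cs S _ (<⇒≤ ε<φ) (FStep-exits-φ≥2 step _ _ S (<⇒≤ ε<φ) (colOut-unique c x y _ u))
FStep-exits-descending (f-there {c@(true , true , z)} {cs} ε<φ step) x y S y<x u =
  ExitChange-∷ c cs S _ (<⇒≤ ε<φ) (FStep-exits-φ≥2 step _ _ S ε<φ (colOut-unique c x y _ u))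

FStep-exits-φ≥2 (f-here {cs = cs} (add-i+1 {z}) φ≤0) x y S _ u = FStep-exits-add z cs x y S φ≤0 u
FStep-exits-φ≥2 (f-here {cs = cs} remove-i φ≤1) x y S φ≥2 u =
  ⊥-elim (<-irrefl refl (subst (λ d → 2 ≤ 1 + d) (m≤n⇒m∸n≡0 φ≤1) φ≥2))
FStep-exits-φ≥2 (f-there {c@(false , false , z)} {cs} ε<φ step) x y S φ≥2 u =
  ExitChange-∷ c cs S _ (<⇒≤ ε<φ) (FStep-exits-φ≥2 step _ _ S φ≥2 (colOut-unique c x y _ u))
FStep-exits-φ≥2 (f-there {c@(true , false , z)} {cs} ε<φ step) x y S _ u@(_ ∷ (y≢z ∷ _) ∷ _) =
  ExitChange-∷ c cs S _ (<⇒≤ ε<φ) (FStep-exits-descending step _ _ S (⊓<⊔ y≢z) (colOut-unique c x y _ u))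
FStep-exits-φ≥2 (f-there {c@(false , true , z)} {cs} ε<φ step) x y S _ u =
  ExitChange-∷ c cs S _ (<⇒≤ ε<φ) (FStep-exits-φ≥2 step _ _ S (<⇒≤ ε<φ) (colOut-unique c x y _ u))
FStep-exits-φ≥2 (f-there {c@(true , true , z)} {cs} ε<φ step) x y S _ u =
  ExitChange-∷ c cs S _ (<⇒≤ ε<φ) (FStep-exits-φ≥2 step _ _ S ε<φ (colOut-unique c x y _ u))

module _ (i : ℕ) where
  open Transposition i

  map-s-above : ∀ {B} → All (suc i <_) B → map (s i) B ≡ B
  map-s-above above = Listₚ.map-id-local (All.map s-fix-above above)

  map-s-passStrip-above : ∀ W x y S → All (suc i <_) (x ∷ y ∷ labels W ++ S) →
                          map (s i) (passStrip W x y S) ≡ passStrip W x y S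
  map-s-passStrip-above W x y S above = map-s-above (All-resp-↭ (↭-sym (passStrip-↭ W x y S)) above)

  -- The small label x runs along row i until it leaves through the top of a
  -- column; every other label is fixed by s_i.
  passStrip-s-upper : ∀ cs x y S → x ≤ suc i → suc i < y → All (suc i <_) (labels cs) → All (suc i <_) S →
                      passStrip cs (s i x) y S ≡ map (s i) (passStrip cs x y S)
  passStrip-s-upper [] x y S _ i<y _ i<S =
    cong₂ _∷_ refl (cong₂ _∷_ (sym (s-fix-above i<y)) (sym (map-s-above i<S)))
  passStrip-s-upper ((false , false , z) ∷ cs) x y S x≤ i<y (i<z ∷ i<cs) i<S
    rewrite m≤n⇒m⊔n≡n (<⇒≤ (≤-trans (s≤s x≤) (≤-trans i<y (m≤m⊔n y z))))
          | m≤n⇒m⊓n≡m (<⇒≤ (≤-trans (s≤s x≤) (≤-trans i<y (m≤m⊔n y z))))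
          | m≤n⇒m⊔n≡n (<⇒≤ (≤-trans (s≤s (s-≤ x≤)) (≤-trans i<y (m≤m⊔n y z))))
          | m≤n⇒m⊓n≡m (<⇒≤ (≤-trans (s≤s (s-≤ x≤)) (≤-trans i<y (m≤m⊔n y z))))
          | s-fix-above (≤-trans i<y (m≤m⊔n y z)) =
    cong (y ⊔ z ∷_) (passStrip-s-upper cs x (y ⊓ z) S x≤ (⊓-glb i<y i<z) i<cs i<S)
  passStrip-s-upper ((true , false , z) ∷ cs) x y S _ i<y (i<z ∷ i<cs) i<S =
    cong (s i x ∷_) (sym (map-s-passStrip-above cs (y ⊔ z) (y ⊓ z) S
      (≤-trans i<y (m≤m⊔n y z) ∷ ⊓-glb i<y i<z ∷ Allₚ.++⁺ i<cs i<S)))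
  passStrip-s-upper ((false , true , z) ∷ cs) x y S x≤ i<y (i<z ∷ i<cs) i<S
    rewrite m≤n⇒m⊔n≡n (<⇒≤ (≤-trans (s≤s x≤) i<y)) | m≤n⇒m⊓n≡m (<⇒≤ (≤-trans (s≤s x≤) i<y))
          | m≤n⇒m⊔n≡n (<⇒≤ (≤-trans (s≤s (s-≤ x≤)) i<y)) | m≤n⇒m⊓n≡m (<⇒≤ (≤-trans (s≤s (s-≤ x≤)) i<y))
          | s-fix-above i<y =
    cong (y ∷_) (passStrip-s-upper cs x z S x≤ i<z i<cs i<S)
  passStrip-s-upper ((true , true , z) ∷ cs) x y S _ i<y (i<z ∷ i<cs) i<S =
    cong (s i x ∷_) (sym (map-s-passStrip-above cs y z S (i<y ∷ i<z ∷ Allₚ.++⁺ i<cs i<S)))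

  FStep-exits-from-i : ∀ {W W′} → FStep W W′ → ∀ S →
    All (suc i <_) (labels W) → All (suc i <_) S → Unique (i ∷ suc i ∷ labels W) →
    ExitChange W S (passStrip W i (suc i) S) (passStrip W′ i (suc i) S)
    ⊎ (φ⊗ W ≡ 1 × passStrip W i (suc i) S ≡ map (s i) (passStrip W′ i (suc i) S))
  FStep-exits-from-i (f-here {cs = cs} (add-i+1 {z}) φ≤0) S _ _ u = inj₁ (FStep-exits-add z cs i (suc i) S φ≤0 u)
  FStep-exits-from-i (f-here {cs = cs} (remove-i {z}) φ≤1) S (i<z ∷ i<cs) i<S _
    rewrite m≤n⇒m⊔n≡n (n≤1+n i) | m≤n⇒m⊓n≡m (n≤1+n i) =
    inj₂ ( cong suc (m≤n⇒m∸n≡0 φ≤1)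
         , cong₂ _∷_ (sym s-right)
             (trans (cong (λ x → passStrip cs x z S) (sym s-left)) (passStrip-s-upper cs i z S (n≤1+n i) i<z i<cs i<S)))
  FStep-exits-from-i (f-there {c@(false , false , z)} {cs} ε<φ step) S (i<z ∷ i<cs) i<S
                     ((i≢i+1 ∷ _ ∷ i∉) ∷ (_ ∷ i+1∉) ∷ _ ∷ u)
    rewrite m≤n⇒m⊔n≡n (<⇒≤ i<z) | m≤n⇒m⊓n≡m (<⇒≤ i<z)
          | m≤n⇒m⊔n≡n (≤-trans (n≤1+n i) (<⇒≤ i<z)) | m≤n⇒m⊓n≡m (≤-trans (n≤1+n i) (<⇒≤ i<z))
    with FStep-exits-from-i step S i<cs i<S ((i≢i+1 ∷ i∉) ∷ i+1∉ ∷ u)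
  ... | inj₁ change       = inj₁ (ExitChange-∷ c cs S z z≤n change)
  ... | inj₂ (φ≡1 , eq) = inj₂ (φ≡1 , cong₂ _∷_ (sym (s-fix-above i<z)) eq)
  FStep-exits-from-i (f-there {c@(true , false , z)} {cs} ε<φ step) S _ _ u@(_ ∷ (i+1≢z ∷ _) ∷ _) =
    inj₁ (ExitChange-∷ c cs S _ (<⇒≤ ε<φ)
      (FStep-exits-descending step _ _ S (⊓<⊔ i+1≢z) (colOut-unique c i (suc i) _ u)))
  FStep-exits-from-i (f-there {c@(false , true , z)} {cs} ε<φ step) S _ _ u =
    inj₁ (ExitChange-∷ c cs S _ (<⇒≤ ε<φ) (FStep-exits-φ≥2 step _ _ S (<⇒≤ ε<φ) (colOut-unique c i (suc i) _ u)))
  FStep-exits-from-i (f-there {c@(true , true , z)} {cs} ε<φ step) S _ _ u =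
    inj₁ (ExitChange-∷ c cs S _ (<⇒≤ ε<φ) (FStep-exits-φ≥2 step _ _ S ε<φ (colOut-unique c i (suc i) _ u)))

  passStrip-Before : ∀ W S → φ⊗ W ≡ 0 → ¬ All Crossing W → All (suc i <_) (labels W) →
                     Before (suc i) i (passStrip W i (suc i) S)
  passStrip-Before [] S _ not-all _ = ⊥-elim (not-all [])
  passStrip-Before ((false , false , z) ∷ cs) S φ≡0 not-all (i<z ∷ i<cs)
    rewrite m≤n⇒m⊔n≡n (<⇒≤ i<z) | m≤n⇒m⊓n≡m (<⇒≤ i<z)
          | m≤n⇒m⊔n≡n (≤-trans (n≤1+n i) (<⇒≤ i<z)) | m≤n⇒m⊓n≡m (≤-trans (n≤1+n i) (<⇒≤ i<z)) =
    skip (>⇒≢ i<z) (>⇒≢ (<-trans (n<1+n i) i<z))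
      (passStrip-Before cs S φ≡0 (λ rest → not-all (crossing ∷ rest)) i<cs)
  passStrip-Before ((false , true , z) ∷ cs) S _ _ _
    rewrite m≤n⇒m⊔n≡n (n≤1+n i) | m≤n⇒m⊓n≡m (n≤1+n i) =
    found (∈-resp-↭ (↭-sym (passStrip-↭ cs i z S)) (here refl))
  passStrip-Before ((true , false , z) ∷ cs) S () _ _
  passStrip-Before ((true , true  , z) ∷ cs) S () _ _

mem-upd-other : ∀ {n} (b : Vec Bool n) k r v → k ≢ r → mem (upd b k v) r ≡ mem b r
mem-upd-other []      k r v _ = refl
mem-upd-other (x ∷ b) zero r v _ = refl
mem-upd-other (x ∷ b) (suc zero)    zero          v _   = refl
mem-upd-other (x ∷ b) (suc zero)    (suc zero)    v 1≢1 = ⊥-elim (1≢1 refl)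
mem-upd-other (x ∷ b) (suc zero)    (suc (suc r)) v _   = refl
mem-upd-other (x ∷ b) (suc (suc k)) zero          v _   = refl
mem-upd-other (x ∷ b) (suc (suc k)) (suc zero)    v _   = refl
mem-upd-other (x ∷ b) (suc (suc k)) (suc (suc r)) v k≢r =
  mem-upd-other b (suc k) (suc r) v (λ eq → k≢r (cong suc eq))

mem-upd-same : ∀ {n} (b : Vec Bool n) k v → 1 ≤ k → k ≤ n → mem (upd b k v) k ≡ v
mem-upd-same (x ∷ b) (suc zero)    v _ _         = refl
mem-upd-same (x ∷ b) (suc (suc k)) v _ (s≤s k<n) = mem-upd-same b (suc k) v (s≤s z≤n) k<n

Maybe-map-nothing⁻ : ∀ {A B : Set} {f : A → B} (r : Maybe A) → Maybe.map f r ≡ nothing → r ≡ nothing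
Maybe-map-nothing⁻ nothing _ = refl

iterCount-≡ : ∀ {A : Set} (g : A → Maybe A) (μ : A → ℕ) →
  (∀ a → g a ≡ nothing → μ a ≡ 0) → (∀ a a′ → g a ≡ just a′ → suc (μ a′) ≡ μ a) →
  ∀ fuel a → μ a ≤ fuel → iterCount g fuel a ≡ μ a
iterCount-≡ g μ stop step zero    a μ≤0 = sym (n≤0⇒n≡0 μ≤0)
iterCount-≡ g μ stop step (suc k) a μ≤ with g a in eq
... | nothing = sym (stop a eq)
... | just a′ = trans (cong suc (iterCount-≡ g μ stop step k a′ (≤-pred (subst (_≤ suc k) (sym (step a a′ eq)) μ≤))))
                      (step a a′ eq)

tupleRow : ∀ {n m} → Vec (Vec Bool n) m → ℕ → List Tile
tupleRow U r = map (λ b → tileOf (mem b r)) (toList U)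

εcol≤2 : ∀ c → εcol c ≤ 2
εcol≤2 (false , false , _) = z≤n
εcol≤2 (true  , false , _) = z≤n
εcol≤2 (true  , true  , _) = s≤s z≤n
εcol≤2 (false , true  , _) = ≤-refl

φcol≤2 : ∀ c → φcol c ≤ 2
φcol≤2 (false , false , _) = z≤n
φcol≤2 (true  , false , _) = ≤-refl
φcol≤2 (true  , true  , _) = s≤s z≤n
φcol≤2 (false , true  , _) = z≤n

module Crystal {n : ℕ} (i : ℕ) (1≤i : 1 ≤ i) (i<n : i < n) where

  column : Vec Bool n → ℕ → Col
  column b z = mem b i , mem b (suc i) , z

  columns : ∀ {m} → Vec (Vec Bool n) m → List ℕ → List Col
  columns []      _        = []
  columns (b ∷ U) []       = []
  columns (b ∷ U) (z ∷ zs) = column b z ∷ columns U zs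

  private
    i≢i+1 : i ≢ suc i
    i≢i+1 = <⇒≢ (n<1+n i)

    upd-i : ∀ b v → mem (upd b i v) i ≡ v
    upd-i b v = mem-upd-same b i v 1≤i (<⇒≤ i<n)

    upd-i+1 : ∀ b v → mem (upd b (suc i) v) (suc i) ≡ v
    upd-i+1 b v = mem-upd-same b (suc i) v (s≤s z≤n) i<n

  e₁-nothing : ∀ b z → e₁ i b ≡ nothing → εcol (column b z) ≡ 0
  e₁-nothing b z eq with mem b i | mem b (suc i)
  ... | false | false = refl
  ... | true  | false = refl

  e₁-just : ∀ {b b′} z → e₁ i b ≡ just b′ → suc (εcol (column b′ z)) ≡ εcol (column b z)
  e₁-just {b} z eq with mem b i in p | mem b (suc i) in q
  e₁-just {b} z refl | false | true
    rewrite upd-i b true | mem-upd-other b i (suc i) true i≢i+1 | q = refl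
  e₁-just {b} z refl | true  | true
    rewrite upd-i+1 b false | mem-upd-other b (suc i) i false (≢-sym i≢i+1) | p = refl

  f₁-nothing : ∀ b z → f₁ i b ≡ nothing → φcol (column b z) ≡ 0
  f₁-nothing b z eq with mem b i | mem b (suc i)
  ... | false | false = refl
  ... | false | true  = refl

  f₁-just : ∀ {b b′} z → f₁ i b ≡ just b′ →
            FCol (column b z) (column b′ z) × (∀ r → r ≢ i → r ≢ suc i → mem b r ≡ mem b′ r)
  f₁-just {b} z eq with mem b i in p | mem b (suc i) in q
  f₁-just {b} z refl | true | false
    rewrite upd-i+1 b true | mem-upd-other b (suc i) i true (≢-sym i≢i+1) | p =
    add-i+1 , λ r _ r≢i+1 → sym (mem-upd-other b (suc i) r true (≢-sym r≢i+1))
  f₁-just {b} z refl | true | true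
    rewrite upd-i b false | mem-upd-other b i (suc i) false i≢i+1 | q =
    remove-i , λ r r≢i _ → sym (mem-upd-other b i r false (≢-sym r≢i))

  ε-subset : ∀ b z → ε subsetOps i b ≡ εcol (column b z)
  ε-subset b z =
    iterCount-≡ (e₁ i) (λ b → εcol (column b z)) (λ b → e₁-nothing b z) (λ _ _ → e₁-just z)
                3 b (m≤n⇒m≤1+n (εcol≤2 (column b z)))

  φ⊗≤fuel : ∀ m (U : Vec (Vec Bool n) m) zs → φ⊗ (columns U zs) ≤ Ops.fuel (tupOps {n} m)
  φ⊗≤fuel zero    []      zs       = z≤n
  φ⊗≤fuel (suc m) (b ∷ U) []       = z≤n
  φ⊗≤fuel (suc m) (b ∷ U) (z ∷ zs) =
    +-mono-≤ (m≤n⇒m≤1+n (φcol≤2 (column b z))) (≤-trans (m∸n≤m _ (εcol (column b z))) (φ⊗≤fuel m U zs))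

  SameOffStrip : ∀ {m} → Vec (Vec Bool n) m → Vec (Vec Bool n) m → Set
  SameOffStrip U U′ = ∀ r → r ≢ i → r ≢ suc i → tupleRow U r ≡ tupleRow U′ r

  FResult : ∀ {m} → Vec (Vec Bool n) m → List ℕ → Maybe (Vec (Vec Bool n) m) → Set
  FResult U zs nothing   = φ⊗ (columns U zs) ≡ 0
  FResult U zs (just U′) = FStep (columns U zs) (columns U′ zs) × SameOffStrip U U′

  f-tail : ∀ {m} b z (U : Vec (Vec Bool n) m) zs → εcol (column b z) < φ⊗ (columns U zs) →
           ∀ r → FResult U zs r → FResult (b ∷ U) (z ∷ zs) (Maybe.map (b ∷_) r)
  f-tail b z U zs ε<φ nothing   φ≡0 = ⊥-elim (n≮0 (subst (εcol (column b z) <_) φ≡0 ε<φ))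
  f-tail b z U zs ε<φ (just U′) (step , same) = f-there ε<φ step , λ r r≢i r≢i+1 → cong (_ ∷_) (same r r≢i r≢i+1)

  f-head : ∀ {m} b z (U : Vec (Vec Bool n) m) zs → φ⊗ (columns U zs) ≤ εcol (column b z) →
           ∀ r → f₁ i b ≡ r → FResult (b ∷ U) (z ∷ zs) (Maybe.map (_∷ U) r)
  f-head b z U zs φ≤ε nothing   eq rewrite f₁-nothing b z eq = m≤n⇒m∸n≡0 φ≤ε
  f-head b z U zs φ≤ε (just b′) eq =
    let col-step , same = f₁-just z eq in
    f-here col-step φ≤ε , λ r r≢i r≢i+1 → cong (_∷ _) (cong tileOf (same r r≢i r≢i+1))

  f-columns : ∀ m (U : Vec (Vec Bool n) m) zs → length zs ≡ m → FResult U zs (Ops.f (tupOps m) i U)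
  φ-columns : ∀ m (U : Vec (Vec Bool n) m) zs → length zs ≡ m → φ (tupOps m) i U ≡ φ⊗ (columns U zs)

  φ-columns m U zs len =
    iterCount-≡ (Ops.f (tupOps m) i) (λ U → φ⊗ (columns U zs))
      (λ U eq → subst (FResult U zs) eq (f-columns m U zs len))
      (λ U U′ eq → FStep-φ (proj₁ (subst (FResult U zs) eq (f-columns m U zs len))))
      (Ops.fuel (tupOps m)) U (φ⊗≤fuel m U zs)

  f-columns zero    []      zs       _   = refl
  f-columns (suc m) (b ∷ U) (z ∷ zs) len = subst (FResult (b ∷ U) (z ∷ zs)) (sym unfold) by-tensor-rule
    where
    c  = column b z
    cs = columns U zs
    len′ = suc-injective len
    unfold : Ops.f (tupOps (suc m)) i (b ∷ U)
           ≡ (if εcol c <ᵇ φ⊗ cs then Maybe.map (b ∷_) (Ops.f (tupOps m) i U) else Maybe.map (_∷ U) (f₁ i b))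
    unfold = cong₂ (λ e p → if e <ᵇ p then Maybe.map (b ∷_) (Ops.f (tupOps m) i U) else Maybe.map (_∷ U) (f₁ i b))
                   (ε-subset b z) (φ-columns m U zs len′)
    by-tensor-rule : FResult (b ∷ U) (z ∷ zs)
      (if εcol c <ᵇ φ⊗ cs then Maybe.map (b ∷_) (Ops.f (tupOps m) i U) else Maybe.map (_∷ U) (f₁ i b))
    by-tensor-rule with εcol c <ᵇ φ⊗ cs | <ᵇ-reflects-< (εcol c) (φ⊗ cs)
    ... | true  | ofʸ ε<φ = f-tail b z U zs ε<φ (Ops.f (tupOps m) i U) (f-columns m U zs len′)
    ... | false | ofⁿ ε≮φ = f-head b z U zs (≮⇒≥ ε≮φ) (f₁ i b) refl

  e-nothing : ∀ m (U : Vec (Vec Bool n) m) zs → length zs ≡ m → Ops.e (tupOps m) i U ≡ nothing →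
              ε⊗ (columns U zs) ≡ 0
  e-nothing zero    []      zs       _   _  = refl
  e-nothing (suc m) (b ∷ U) (z ∷ zs) len eq = by-tensor-rule (trans (sym unfold) eq)
    where
    c  = column b z
    cs = columns U zs
    len′ = suc-injective len
    unfold : Ops.e (tupOps (suc m)) i (b ∷ U)
           ≡ (if εcol c ≤ᵇ φ⊗ cs then Maybe.map (b ∷_) (Ops.e (tupOps m) i U) else Maybe.map (_∷ U) (e₁ i b))
    unfold = cong₂ (λ e p → if e ≤ᵇ p then Maybe.map (b ∷_) (Ops.e (tupOps m) i U) else Maybe.map (_∷ U) (e₁ i b))
                   (ε-subset b z) (φ-columns m U zs len′)
    by-tensor-rule : (if εcol c ≤ᵇ φ⊗ cs then Maybe.map (b ∷_) (Ops.e (tupOps m) i U) else Maybe.map (_∷ U) (e₁ i b))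
                     ≡ nothing → ε⊗ (c ∷ cs) ≡ 0
    by-tensor-rule with εcol c ≤ᵇ φ⊗ cs | ≤ᵇ-reflects-≤ (εcol c) (φ⊗ cs)
    ... | true  | ofʸ ε≤φ = λ eq′ →
      cong₂ _+_ (e-nothing m U zs len′ (Maybe-map-nothing⁻ _ eq′)) (m≤n⇒m∸n≡0 ε≤φ)
    ... | false | ofⁿ ε≰φ = λ eq′ →
      ⊥-elim (ε≰φ (subst (_≤ φ⊗ cs) (sym (e₁-nothing b z (Maybe-map-nothing⁻ _ eq′))) z≤n))

  labels-columns : ∀ {m} (U : Vec (Vec Bool n) m) zs → length zs ≡ m → labels (columns U zs) ≡ zs
  labels-columns []      []       _   = refl
  labels-columns (b ∷ U) (z ∷ zs) len = cong (z ∷_) (labels-columns U zs (suc-injective len))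

  length-columns : ∀ {m} (U : Vec (Vec Bool n) m) zs → length zs ≡ m → length (columns U zs) ≡ m
  length-columns []      []       _   = refl
  length-columns (b ∷ U) (z ∷ zs) len = cong suc (length-columns U zs (suc-injective len))

  passRow-strip : ∀ {m} (U : Vec (Vec Bool n) m) zs R x y → length zs ≡ m →
    passRow (tupleRow U i) (x ∷ passRow (tupleRow U (suc i)) (y ∷ zs ++ R)) ≡ passStrip (columns U zs) x y R
  passRow-strip []      []       R x y _   = refl
  passRow-strip (b ∷ U) (z ∷ zs) R x y len = cong (_ ∷_) (passRow-strip U zs R _ _ (suc-injective len))

  crossing-rows⇒crossing : ∀ {m} (U : Vec (Vec Bool n) m) zs → length zs ≡ m →
    All (_≡ cross) (tupleRow U i) → All (_≡ cross) (tupleRow U (suc i)) → All Crossing (columns U zs)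
  crossing-rows⇒crossing []      []       _   _ _ = []
  crossing-rows⇒crossing (b ∷ U) (z ∷ zs) len row-i row-i+1 with mem b i | mem b (suc i)
  crossing-rows⇒crossing (b ∷ U) (z ∷ zs) len (_ ∷ row-i) (_ ∷ row-i+1) | false | false =
    crossing ∷ crossing-rows⇒crossing U zs (suc-injective len) row-i row-i+1
  crossing-rows⇒crossing (b ∷ U) (z ∷ zs) len (() ∷ _) _        | true  | _
  crossing-rows⇒crossing (b ∷ U) (z ∷ zs) len _        (() ∷ _) | false | true

  crossing⇒crossing-rows : ∀ {m} (U : Vec (Vec Bool n) m) zs → length zs ≡ m → All Crossing (columns U zs) →
    All (_≡ cross) (tupleRow U i) × All (_≡ cross) (tupleRow U (suc i))
  crossing⇒crossing-rows []      []       _   _ = [] , []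
  crossing⇒crossing-rows (b ∷ U) (z ∷ zs) len all with mem b i | mem b (suc i)
  crossing⇒crossing-rows (b ∷ U) (z ∷ zs) len (crossing ∷ all) | false | false =
    let row-i , row-i+1 = crossing⇒crossing-rows U zs (suc-injective len) all in
    refl ∷ row-i , refl ∷ row-i+1

rowPass-passRow : ∀ {m} a (ts : Vec Tile m) (bs : Vec ℕ m) S →
  passRow (toList ts) (a ∷ toList bs ++ S) ≡ toList (proj₁ (rowPass a ts bs)) ++ proj₂ (rowPass a ts bs) ∷ S
rowPass-passRow a []       []       S = refl
rowPass-passRow a (t ∷ ts) (b ∷ bs) S with tileOut t a b
... | top , r with rowPass r ts bs | rowPass-passRow r ts bs S
...   | tops , r′ | eq = cong (top ∷_) eq

pass-passRows : ∀ {m k} (row : ℕ → List Tile) r (D : Vec (Vec Tile m) k) (bots : Vec ℕ m) →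
  (∀ q → toList (lookup D q) ≡ row (r + toℕ q)) →
  toList (proj₁ (pass r D bots)) ++ toList (proj₂ (pass r D bots)) ≡ passRows row r k (toList bots)
pass-passRows row r []       bots _ = Listₚ.++-identityʳ _
pass-passRows row r (ts ∷ D) bots rows
  with pass (suc r) D bots
     | pass-passRows row (suc r) D bots (λ q → trans (rows (fsuc q)) (cong row (+-suc r (toℕ q))))
... | tops′ , rights | eq with rowPass r ts tops′ | rowPass-passRow r ts tops′ (toList rights)
...   | tops , right | eq′ =
  trans (sym eq′) (cong₂ (λ row-r K → passRow row-r (r ∷ K)) (trans (rows fzero) (cong row (+-identityʳ r))) eq)

mem-suc-toℕ : ∀ {n} (b : Vec Bool n) q → mem b (suc (toℕ q)) ≡ lookup b q
mem-suc-toℕ (x ∷ b) fzero    = refl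
mem-suc-toℕ (x ∷ b) (fsuc q) = mem-suc-toℕ b q

row-fromTuple : ∀ {m n} (U : Vec (Vec Bool n) m) q → toList (lookup (fromTuple U) q) ≡ tupleRow U (suc (toℕ q))
row-fromTuple U q = trans (cong toList (Vecₚ.lookup∘tabulate _ q)) (by-columns U)
  where
  by-columns : ∀ {m} (U : Vec (Vec Bool _) m) →
    toList (tabulate (λ j → tileOf (lookup (lookup U j) q))) ≡ tupleRow U (suc (toℕ q))
  by-columns []      = refl
  by-columns (b ∷ U) = cong₂ _∷_ (cong tileOf (sym (mem-suc-toℕ b q))) (by-columns U)

σ-fromTuple : ∀ {m n} (U : Vec (Vec Bool n) m) →
              σ (fromTuple U) ≡ passRows (tupleRow U) 1 n (toList (bottomLabels m n))
σ-fromTuple {m} {n} U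
  with pass 1 (fromTuple U) (bottomLabels m n)
     | pass-passRows (tupleRow U) 1 (fromTuple U) (bottomLabels m n) (row-fromTuple U)
... | tops , rights | eq = eq

tileOf-isBump : ∀ t → tileOf (isBump t) ≡ t
tileOf-isBump bump  = refl
tileOf-isBump cross = refl

isBump-tileOf : ∀ b → isBump (tileOf b) ≡ b
isBump-tileOf true  = refl
isBump-tileOf false = refl

fromTuple-toTuple : ∀ {m n} (D : RPD m n) → fromTuple (toTuple D) ≡ D
fromTuple-toTuple D =
  trans (Vecₚ.tabulate-cong (λ r → trans (Vecₚ.tabulate-cong (tile r)) (Vecₚ.tabulate∘lookup (lookup D r))))
        (Vecₚ.tabulate∘lookup D)
  where
  tile : ∀ r j → tileOf (lookup (lookup (toTuple D) j) r) ≡ lookup (lookup D r) j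
  tile r j = trans (cong (λ col → tileOf (lookup col r)) (Vecₚ.lookup∘tabulate _ j))
                   (trans (cong tileOf (Vecₚ.lookup-map r _ D)) (tileOf-isBump _))

toTuple-fromTuple : ∀ {m n} (U : Vec (Vec Bool n) m) → toTuple (fromTuple U) ≡ U
toTuple-fromTuple U =
  trans (Vecₚ.tabulate-cong (λ j → trans (sym (Vecₚ.tabulate-∘ _ _))
          (trans (Vecₚ.tabulate-cong (entry j)) (Vecₚ.tabulate∘lookup (lookup U j)))))
        (Vecₚ.tabulate∘lookup U)
  where
  entry : ∀ j r → isBump (lookup (tabulate (λ j′ → tileOf (lookup (lookup U j′) r))) j) ≡ lookup (lookup U j) r
  entry j r = trans (cong isBump (Vecₚ.lookup∘tabulate _ j)) (isBump-tileOf _)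

RowAllCross-fromTuple : ∀ {m n} (U : Vec (Vec Bool n) m) r → r < n →
                        RowAllCross (fromTuple U) (suc r) ⇔ All (_≡ cross) (tupleRow U (suc r))
RowAllCross-fromTuple U r r<n = mk⇔
  (λ crosses → subst (λ r′ → All (_≡ cross) (tupleRow U (suc r′))) (Finₚ.toℕ-fromℕ< r<n)
                 (subst (All (_≡ cross)) (row-fromTuple U (fromℕ< r<n))
                   (crosses (fromℕ< r<n) (cong suc (Finₚ.toℕ-fromℕ< r<n)))))
  (λ { crosses q refl → subst (All (_≡ cross)) (sym (row-fromTuple U q)) crosses })

RowAllCross-toTuple : ∀ {m n} (D : RPD m n) r → r < n →
                      RowAllCross D (suc r) ⇔ All (_≡ cross) (tupleRow (toTuple D) (suc r))
RowAllCross-toTuple D r r<n =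
  subst (λ D′ → RowAllCross D′ (suc r) ⇔ All (_≡ cross) (tupleRow (toTuple D) (suc r)))
        (fromTuple-toTuple D) (RowAllCross-fromTuple (toTuple D) r r<n)

bottomLabels-range : ∀ m n → toList (bottomLabels m n) ≡ range (suc n) m
bottomLabels-range zero    n = refl
bottomLabels-range (suc m) n =
  cong₂ _∷_ (trans (+-suc n 0) (cong suc (+-identityʳ n)))
    (trans (cong toList (Vecₚ.tabulate-cong (λ j → +-suc n (suc (toℕ j))))) (bottomLabels-range m (suc n)))

-- Rows 1, …, above lie above the strip formed by rows i = above + 1 and
-- i + 1, and rows i + 2, …, n below it.
module StripDecomposition (m n above below : ℕ) (n≡ : suc (suc above) + below ≡ n) where

  i : ℕ
  i = suc above

  private
    i<n : i < n
    i<n = subst (i <_) n≡ (m≤m+n (suc i) below)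

  open Crystal {n} i (s≤s z≤n) i<n public
  open Transposition i

  Tuple : Set
  Tuple = Vec (Vec Bool n) m

  bottom : List ℕ
  bottom = toList (bottomLabels m n)

  belowStrip : Tuple → List ℕ
  belowStrip U = passRows (tupleRow U) (suc (suc i)) below bottom

  -- The labels leaving the rows below the strip, first through the top edge
  -- and then on the right.
  entering passing : Tuple → List ℕ
  entering U = take m (belowStrip U)
  passing  U = drop m (belowStrip U)

  strip : Tuple → List Col
  strip U = columns U (entering U)

  stripOut : Tuple → List ℕ
  stripOut U = passStrip (strip U) i (suc i) (passing U)

  aboveStrip : Tuple → List ℕ → List ℕ
  aboveStrip U = passRows (tupleRow U) 1 above

  entering-length : ∀ U → length (entering U) ≡ m
  entering-length U =
    trans (Listₚ.length-take m (belowStrip U))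
      (trans (cong (m ⊓_) (trans (passRows-length (tupleRow U) _ below bottom)
                                 (cong (below +_) (Vecₚ.length-toList (bottomLabels m n)))))
             (m≤n⇒m⊓n≡m (m≤n+m m below)))

  strip-length : ∀ U → length (strip U) ≡ m
  strip-length U = length-columns U (entering U) (entering-length U)

  labels-strip : ∀ U → labels (strip U) ≡ entering U
  labels-strip U = labels-columns U (entering U) (entering-length U)

  belowStrip-split : ∀ U → belowStrip U ≡ entering U ++ passing U
  belowStrip-split U = sym (Listₚ.take++drop≡id m (belowStrip U))

  σ-decomposition : ∀ U → σ (fromTuple U) ≡ aboveStrip U (stripOut U)
  σ-decomposition U = begin
    σ (fromTuple U)                                       ≡⟨ σ-fromTuple U ⟩
    passRows row 1 n bottom                               ≡⟨ cong (λ k → passRows row 1 k bottom) n≡′ ⟩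
    passRows row 1 (above + suc (suc below)) bottom       ≡⟨ passRows-+ row 1 above (suc (suc below)) bottom ⟩
    aboveStrip U (passRow (row i) (i ∷ passRow (row (suc i)) (suc i ∷ belowStrip U)))
      ≡⟨ cong (λ K → aboveStrip U (passRow (row i) (i ∷ passRow (row (suc i)) (suc i ∷ K)))) (belowStrip-split U) ⟩
    aboveStrip U (passRow (row i) (i ∷ passRow (row (suc i)) (suc i ∷ entering U ++ passing U)))
      ≡⟨ cong (aboveStrip U) (passRow-strip U (entering U) (passing U) i (suc i) (entering-length U)) ⟩
    aboveStrip U (stripOut U)                             ∎
    where
    open ≡-Reasoning
    row = tupleRow U
    n≡′ : n ≡ above + suc (suc below)
    n≡′ = trans (sym n≡) (trans (cong suc (sym (+-suc above below))) (sym (+-suc above (suc below))))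

  belowStrip-↭ : ∀ U → belowStrip U ↭ range (suc (suc i)) (below + m)
  belowStrip-↭ U = subst (belowStrip U ↭_) ranges (passRows-↭ (tupleRow U) (suc (suc i)) below bottom)
    where
    ranges : range (suc (suc i)) below ++ bottom ≡ range (suc (suc i)) (below + m)
    ranges = trans (cong (range (suc (suc i)) below ++_)
                         (trans (bottomLabels-range m n) (cong (λ n′ → range (suc n′) m) (sym n≡))))
                   (range-++ (suc (suc i)) below m)

  belowStrip-above : ∀ U → All (suc i <_) (belowStrip U)
  belowStrip-above U = All-resp-↭ (↭-sym (belowStrip-↭ U)) (range-lower (suc (suc i)) (below + m))

  strip-above : ∀ U → All (suc i <_) (labels (strip U))
  strip-above U = subst (All (suc i <_)) (sym (labels-strip U))
                    (Allₚ.++⁻ˡ (entering U) (subst (All (suc i <_)) (belowStrip-split U) (belowStrip-above U)))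

  passing-above : ∀ U → All (suc i <_) (passing U)
  passing-above U = Allₚ.++⁻ʳ (entering U) (subst (All (suc i <_)) (belowStrip-split U) (belowStrip-above U))

  strip-unique : ∀ U → Unique (i ∷ suc i ∷ labels (strip U))
  strip-unique U = subst (λ zs → Unique (i ∷ suc i ∷ zs)) (sym (labels-strip U))
    (Uniqueₚ.take⁺ (suc (suc m))
      (Unique-resp-↭ (↭-sym (prep i (prep (suc i) (belowStrip-↭ U)))) (range-unique i (suc (suc (below + m))))))

  stripOut-↭ : ∀ U → stripOut U ↭ range i (suc (suc (below + m)))
  stripOut-↭ U =
    ↭-trans (passStrip-↭ (strip U) i (suc i) (passing U))
      (subst (λ K → i ∷ suc i ∷ K ↭ range i (suc (suc (below + m)))) (sym labels-below)
        (prep i (prep (suc i) (belowStrip-↭ U))))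
    where
    labels-below : labels (strip U) ++ passing U ≡ belowStrip U
    labels-below = trans (cong (_++ passing U) (labels-strip U)) (sym (belowStrip-split U))

  above-stripOut-unique : ∀ U → Unique (range 1 above ++ stripOut U)
  above-stripOut-unique U =
    Unique-resp-↭ (↭-sym (++⁺ˡ (range 1 above) (stripOut-↭ U)))
      (subst Unique (sym (range-++ 1 above _)) (range-unique 1 (above + suc (suc (below + m)))))

  aboveStrip-++ : ∀ U A K → length A ≡ m → aboveStrip U (A ++ K) ≡ aboveStrip U A ++ K
  aboveStrip-++ U A K length-A =
    passRows-++ (tupleRow U) 1 above A K
      (λ r → ≤-reflexive (trans (Listₚ.length-map _ (toList U)) (trans (Vecₚ.length-toList U) (sym length-A))))

  aboveStrip-position : ∀ U A → length A ≡ m → m + i ≡ suc (length (aboveStrip U A))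
  aboveStrip-position U A length-A =
    trans (+-suc m above)
      (cong suc (trans (+-comm m above)
        (sym (trans (passRows-length (tupleRow U) 1 above A) (cong (above +_) length-A)))))

  σ-exits : ∀ U → at (σ (fromTuple U)) (m + i) ≡ proj₁ (stripExits (strip U) i (suc i))
                × at (σ (fromTuple U)) (m + suc i) ≡ proj₂ (stripExits (strip U) i (suc i))
  σ-exits U with passStrip-exits (strip U) i (suc i) (passing U)
  ... | A , length-A , eq =
    trans (cong₂ at σ≡ position) (at-middle (aboveStrip U A) _ _) ,
    trans (cong₂ at σ≡ (trans (+-suc m i) (cong suc position))) (at-middle₂ (aboveStrip U A) _ _ _)
    where
    length-A′ = trans length-A (strip-length U)
    position = aboveStrip-position U A length-A′
    σ≡ : σ (fromTuple U) ≡ aboveStrip U A ++ _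
    σ≡ = trans (σ-decomposition U) (trans (cong (aboveStrip U) eq) (aboveStrip-++ U A _ length-A′))

  aboveStrip-swap : ∀ U {A} P Q R → length A ≡ m →
                    aboveStrip U (A ++ Q ∷ P ∷ R) ≡ mulS (aboveStrip U (A ++ P ∷ Q ∷ R)) (m + i)
  aboveStrip-swap U {A} P Q R length-A =
    sym (trans (cong₂ mulS (aboveStrip-++ U A _ length-A) (aboveStrip-position U A length-A))
               (trans (mulS-swap (aboveStrip U A) P Q R) (sym (aboveStrip-++ U A _ length-A))))

  belowStrip-same : ∀ {U U′} → SameOffStrip U U′ → belowStrip U′ ≡ belowStrip U
  belowStrip-same same = passRows-cong (suc (suc i)) below _
    (λ r i+2≤r _ → sym (same r (>⇒≢ (≤-trans (n≤1+n (suc i)) i+2≤r)) (>⇒≢ i+2≤r)))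

  aboveStrip-same : ∀ {U U′} → SameOffStrip U U′ → ∀ K → aboveStrip U′ K ≡ aboveStrip U K
  aboveStrip-same same K = passRows-cong 1 above K
    (λ r _ r<i → sym (same r (<⇒≢ r<i) (<⇒≢ (<-trans r<i (n<1+n i)))))

  data StepEffect (W : List Col) (u u′ : List ℕ) : Set where
    unchanged  : u′ ≡ u → StepEffect W u u′
    swapped    : ε⊗ W ≡ 0 → u′ ≡ mulS u (m + i) → StepEffect W u u′
    relabelled : φ⊗ W ≡ 1 → u ≡ u′ ⊎ u ≡ Smul i u′ → StepEffect W u u′

  StepEffect-ε≢0 : ∀ {W u u′} → StepEffect W u u′ → ε⊗ W ≢ 0 → u ≡ u′ ⊎ u ≡ Smul i u′
  StepEffect-ε≢0 (unchanged u′≡u)   _   = inj₁ (sym u′≡u)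
  StepEffect-ε≢0 (swapped ε≡0 _)    ε≢0 = ⊥-elim (ε≢0 ε≡0)
  StepEffect-ε≢0 (relabelled _ eq)  _   = eq

  StepEffect-φ≢1 : ∀ {W u u′} → StepEffect W u u′ → φ⊗ W ≢ 1 → u′ ≡ u ⊎ u′ ≡ mulS u (m + i)
  StepEffect-φ≢1 (unchanged u′≡u)   _   = inj₁ u′≡u
  StepEffect-φ≢1 (swapped _ eq)     _   = inj₂ eq
  StepEffect-φ≢1 (relabelled φ≡1 _) φ≢1 = ⊥-elim (φ≢1 φ≡1)

  StepEffect-trivial : ∀ {W u u′} → StepEffect W u u′ → ε⊗ W ≢ 0 → φ⊗ W ≢ 1 → u′ ≡ u
  StepEffect-trivial (unchanged u′≡u)   _   _   = u′≡u
  StepEffect-trivial (swapped ε≡0 _)    ε≢0 _   = ⊥-elim (ε≢0 ε≡0)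
  StepEffect-trivial (relabelled φ≡1 _) _   φ≢1 = ⊥-elim (φ≢1 φ≡1)

  module _ (U U′ : Tuple) (same : SameOffStrip U U′) where

    private
      O′ : List ℕ
      O′ = passStrip (columns U′ (entering U)) i (suc i) (passing U)

      O′-stripOut : stripOut U′ ≡ O′
      O′-stripOut = cong (λ K → passStrip (columns U′ (take m K)) i (suc i) (drop m K)) (belowStrip-same same)

      σ′≡ : σ (fromTuple U′) ≡ aboveStrip U O′
      σ′≡ = trans (σ-decomposition U′) (trans (cong (aboveStrip U′) O′-stripOut) (aboveStrip-same same O′))

    f-effect : FStep (strip U) (columns U′ (entering U)) → StepEffect (strip U) (σ (fromTuple U)) (σ (fromTuple U′))
    f-effect step with FStep-exits-from-i i step (passing U) (strip-above U) (passing-above U) (strip-unique U)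
    ... | inj₁ (inj₁ O′≡O) = unchanged (trans σ′≡ (trans (cong (aboveStrip U) O′≡O) (sym (σ-decomposition U))))
    ... | inj₁ (inj₂ (ε≡0 , A , P , Q , length-A , O≡ , O′≡)) = swapped ε≡0 σ-swapped
      where
      open ≡-Reasoning
      σ-swapped : σ (fromTuple U′) ≡ mulS (σ (fromTuple U)) (m + i)
      σ-swapped = begin
        σ (fromTuple U′)                                       ≡⟨ σ′≡ ⟩
        aboveStrip U O′                                        ≡⟨ cong (aboveStrip U) O′≡ ⟩
        aboveStrip U (A ++ Q ∷ P ∷ passing U)
          ≡⟨ aboveStrip-swap U P Q (passing U) (trans length-A (strip-length U)) ⟩
        mulS (aboveStrip U (A ++ P ∷ Q ∷ passing U)) (m + i)
          ≡⟨ cong (λ O → mulS (aboveStrip U O) (m + i)) (sym O≡) ⟩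
        mulS (aboveStrip U (stripOut U)) (m + i)
          ≡⟨ cong (λ u → mulS u (m + i)) (sym (σ-decomposition U)) ⟩
        mulS (σ (fromTuple U)) (m + i)                         ∎
    ... | inj₂ (φ≡1 , O≡sO′) = relabelled φ≡1 relabel
      where
      σ≡ : σ (fromTuple U) ≡ aboveStrip U (map (s i) O′)
      σ≡ = trans (σ-decomposition U) (cong (aboveStrip U) O≡sO′)
      relabel : σ (fromTuple U) ≡ σ (fromTuple U′) ⊎ σ (fromTuple U) ≡ Smul i (σ (fromTuple U′))
      relabel with passRows-map-s (tupleRow U) 1 above O′ ≤-refl
                        (subst (λ O → Unique (range 1 above ++ O)) O′-stripOut (above-stripOut-unique U′))
      ... | inj₁ passRow-map-s-∷s = inj₂ (trans σ≡ (trans passRow-map-s-∷s (cong (map (s i)) (sym σ′≡))))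
      ... | inj₂ merges   = inj₁ (trans σ≡ (trans merges (sym σ′≡)))

  rows-crossing⇔strip-crossing : ∀ D → (RowAllCross D i × RowAllCross D (suc i)) ⇔ All Crossing (strip (toTuple D))
  rows-crossing⇔strip-crossing D = mk⇔
    (λ (row-i , row-i+1) → crossing-rows⇒crossing U (entering U) (entering-length U) (to row-i⇔ row-i) (to row-i+1⇔ row-i+1))
    (λ all → let row-i , row-i+1 = crossing⇒crossing-rows U (entering U) (entering-length U) all in
             from row-i⇔ row-i , from row-i+1⇔ row-i+1)
    where
    open Equivalence
    U = toTuple D
    row-i⇔   = RowAllCross-toTuple D above (<-trans (n<1+n above) i<n)
    row-i+1⇔ = RowAllCross-toTuple D i i<n

-- i-strings

module StringAnalysis (m n above below : ℕ) (n≡ : suc (suc above) + below ≡ n)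
                      (Ds : ℕ → RPD m n) (l : ℕ) (string : IsString (suc above) Ds l) where

  open StripDecomposition m n above below n≡ public

  U : ℕ → Tuple
  U j = toTuple (Ds j)

  W : ℕ → List Col
  W j = strip (U j)

  u : ℕ → List ℕ
  u j = σ (Ds j)

  u≡ : ∀ j → u j ≡ σ (fromTuple (U j))
  u≡ j = cong σ (sym (fromTuple-toTuple (Ds j)))

  f-U : ∀ j → j < l → Ops.f (tupOps m) i (U j) ≡ just (U (suc j))
  f-U j j<l with Ops.f (tupOps m) i (U j) | proj₁ (proj₂ string) j j<l
  ... | just U′ | eq = cong just (trans (sym (toTuple-fromTuple U′)) (cong toTuple (Maybeₚ.just-injective eq)))

  f-result : ∀ j → j < l → FStep (W j) (columns (U (suc j)) (entering (U j))) × SameOffStrip (U j) (U (suc j))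
  f-result j j<l = subst (FResult (U j) (entering (U j))) (f-U j j<l)
                     (f-columns m (U j) (entering (U j)) (entering-length (U j)))

  f-step : ∀ j → j < l → FStep (W j) (W (suc j))
  f-step j j<l = let step , same = f-result j j<l in
    subst (FStep (W j)) (cong (λ K → columns (U (suc j)) (take m K)) (sym (belowStrip-same same))) step

  step-effect : ∀ j → j < l → StepEffect (W j) (u j) (u (suc j))
  step-effect j j<l = let step , same = f-result j j<l in
    subst₂ (StepEffect (W j)) (sym (u≡ j)) (sym (u≡ (suc j))) (f-effect (U j) (U (suc j)) same step)

  ε-W0 : ε⊗ (W 0) ≡ 0
  ε-W0 = e-nothing m (U 0) (entering (U 0)) (entering-length (U 0)) (Maybe-map-nothing⁻ _ (proj₁ string))

  φ-Wl : φ⊗ (W l) ≡ 0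
  φ-Wl = subst (FResult (U l) (entering (U l))) (Maybe-map-nothing⁻ _ (proj₂ (proj₂ string)))
           (f-columns m (U l) (entering (U l)) (entering-length (U l)))

  ε-W≢0 : ∀ j → j < l → ε⊗ (W (suc j)) ≢ 0
  ε-W≢0 j j<l ε≡0 with trans (sym (FStep-ε (f-step j j<l))) ε≡0
  ... | ()

  φ-W≢1 : ∀ j → suc j < l → φ⊗ (W j) ≢ 1
  φ-W≢1 j j+1<l φ≡1
    with trans (trans (cong suc (FStep-φ (f-step (suc j) j+1<l))) (FStep-φ (f-step j (<-trans (n<1+n j) j+1<l)))) φ≡1
  ... | ()

  all-crossing : All Crossing (W 0) → l ≡ 0 × at (u 0) (m + i) ≡ i × at (u 0) (m + suc i) ≡ suc i
  all-crossing all = l≡0 , trans (cong (λ v → at v (m + i)) (u≡ 0)) (trans upper (cong proj₁ exits)) ,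
                          trans (cong (λ v → at v (m + suc i)) (u≡ 0)) (trans lower (cong proj₂ exits))
    where
    upper = proj₁ (σ-exits (U 0))
    lower = proj₂ (σ-exits (U 0))
    exits = crossing-exits (W 0) i (suc i) all (All.map (<-trans (n<1+n i)) (strip-above (U 0))) (strip-above (U 0))
    l≡0 : l ≡ 0
    l≡0 = n≤0⇒n≡0 (≮⇒≥ λ 0<l → 1+n≢0 (trans (FStep-φ (f-step 0 0<l)) (All-crossing-φ all)))

  exits-decrease : ¬ All Crossing (W 0) → at (u 0) (m + suc i) < at (u 0) (m + i)
  exits-decrease not-all =
    subst₂ _<_ (sym (trans (cong (λ v → at v (m + suc i)) (u≡ 0)) (proj₂ (σ-exits (U 0)))))
               (sym (trans (cong (λ v → at v (m + i)) (u≡ 0)) (proj₁ (σ-exits (U 0)))))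
               (exits-descending (W 0) i (suc i) ε-W0 not-all (strip-unique (U 0)))

  not-crossing-later : ¬ All Crossing (W 0) → ∀ j → j ≤ l → ¬ All Crossing (W j)
  not-crossing-later not-all zero    _   = not-all
  not-crossing-later not-all (suc j) j<l = FStep-not-crossing (f-step j j<l)

  inverse-decreases : ¬ All Crossing (W 0) → inv (u l) (suc i) < inv (u l) i
  inverse-decreases not-all =
    subst (λ v → inv v (suc i) < inv v i) (sym (u≡ l))
      (Before⇒invFrom< 1 (σ (fromTuple (U l)))
        (subst (Before (suc i) i) (sym (σ-decomposition (U l)))
          (Before-passRows (tupleRow (U l)) 1 above (stripOut (U l)) (n<1+n i) ≤-refl
            (passStrip-Before i (W l) (passing (U l)) φ-Wl (not-crossing-later not-all l ≤-refl) (strip-above (U l)))))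
        (>⇒≢ (n<1+n i)))

  middle-constant : ∀ j → 1 ≤ j → j < l → u j ≡ u 1
  middle-constant (suc zero)    _ _     = refl
  middle-constant (suc (suc j)) _ j+2<l =
    trans (StepEffect-trivial (step-effect (suc j) j+1<l) (ε-W≢0 j (<-trans (n<1+n j) j+1<l)) (φ-W≢1 (suc j) j+2<l))
          (middle-constant (suc j) (s≤s z≤n) j+1<l)
    where j+1<l = <-trans (n<1+n (suc j)) j+2<l

  first-step : 1 < l → u 1 ≡ u 0 ⊎ u 1 ≡ mulS (u 0) (m + i)
  first-step 1<l = StepEffect-φ≢1 (step-effect 0 (<-trans z<s 1<l)) (φ-W≢1 0 1<l)

  last-step : ∀ k → 1 ≤ k → suc k ≡ l → u k ≡ u l ⊎ u k ≡ Smul i (u l)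
  last-step (suc k) _ refl = StepEffect-ε≢0 (step-effect (suc k) ≤-refl) (ε-W≢0 k (m<n⇒m<1+n (n<1+n k)))

  middle : ∀ j → 1 ≤ j → j < l →
           u j ≡ u 1 × (u j ≡ u 0 ⊎ u j ≡ mulS (u 0) (m + i)) × (u j ≡ u l ⊎ u j ≡ Smul i (u l))
  middle j 1≤j j<l with m≤n⇒∃[o]m+o≡n (≤-<-trans z≤n j<l)
  ... | k , k+1≡l =
    u-j≡u-1 ,
    Sum.map (trans u-j≡u-1) (trans u-j≡u-1) (first-step (≤-<-trans 1≤j j<l)) ,
    Sum.map (trans u-j≡u-k) (trans u-j≡u-k) (last-step k 1≤k k+1≡l)
    where
    u-j≡u-1 = middle-constant j 1≤j j<l
    1≤k = ≤-trans 1≤j (≤-pred (subst (j <_) (sym k+1≡l) j<l))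
    u-j≡u-k = trans u-j≡u-1 (sym (middle-constant k 1≤k (subst (k <_) k+1≡l ≤-refl)))

proposition4p4 : (m n i : ℕ) → 1 ≤ i → i < n →
    (Ds : ℕ → RPD m n) (l : ℕ) → IsString i Ds l →
    ((RowAllCross (Ds 0) i × RowAllCross (Ds 0) (suc i)) →
      (l ≡ 0) × (at (σ (Ds 0)) (m + i) ≡ i) × (at (σ (Ds 0)) (m + suc i) ≡ suc i))
    ×
    (¬ (RowAllCross (Ds 0) i × RowAllCross (Ds 0) (suc i)) →
      (at (σ (Ds 0)) (m + suc i) < at (σ (Ds 0)) (m + i))
      × (inv (σ (Ds l)) (suc i) < inv (σ (Ds l)) i)
      × (∀ j → 1 ≤ j → j < l →
           (σ (Ds j) ≡ σ (Ds 1))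
           × ((σ (Ds j) ≡ σ (Ds 0)) ⊎ (σ (Ds j) ≡ mulS (σ (Ds 0)) (m + i)))
           × ((σ (Ds j) ≡ σ (Ds l)) ⊎ (σ (Ds j) ≡ Smul i (σ (Ds l))))))
proposition4p4 m n (suc above) (s≤s z≤n) i<n Ds l string =
  (λ rows-crossing → all-crossing (to rows-crossing)) ,
  (λ not-rows-crossing → let not-crossing = λ all → not-rows-crossing (from all) in
    exits-decrease not-crossing , inverse-decreases not-crossing , middle)
  where
  below = proj₁ (m≤n⇒∃[o]m+o≡n i<n)
  open StringAnalysis m n above below (proj₂ (m≤n⇒∃[o]m+o≡n i<n)) Ds l string
  open Equivalence (rows-crossing⇔strip-crossing (Ds 0))
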